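{- Let $\mathcal{M}\in\{\mathrm{rank},\mathsf{PDT}\}$. (1) If there are constants $c_1,k_1>0$ such that for every $n\ge2$ and every Boolean function $f:\{0,1\}^n\to\{0,1\}$, $\mathcal{M}(f)\le c_1\deg(f)^2(\log n)^{k_1}$, then there are constants $c_2,k_2>0$ such that for every $n\ge2$ and every $f:\{0,1\}^n\to\{0,1\}$, $\mathrm{D}(f)\le c_2\deg(f)^2(\log n)^{k_2}$. (2) If there are constants $c_1,k_1>0$ such that for every $n\ge2$ and every $f:\{0,1\}^n\to\{0,1\}$, $\mathcal{M}(f)\le c_1\mathrm{bs}(f)^2(\log n)^{k_1}$, then there are constants $c_2,k_2>0$ such that for every $n\ge2$ and every $f:\{0,1\}^n\to\{0,1\}$, $\mathrm{D}(f)\le c_2\mathrm{fbs}(f)^2(\log n)^{k_2}$.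
   Context: Logarithms are base 2. $\mathrm{D}(f)$ is the minimum depth of a deterministic decision tree (each internal node queries a single input bit, branching on its value; leaves labelled $0/1$) computing $f$. Rank of a decision tree: a leaf has rank $0$; an internal node with children of ranks $r_1,r_2$ has rank $\max(r_1,r_2)$ if $r_1\ne r_2$ and $r_1+1$ if $r_1=r_2$; the tree's rank is the rank of its root; $\mathrm{rank}(f)$ is the minimum rank of a decision tree computing $f$. A parity decision tree is like a decision tree but each internal node is labelled by a set $S\subseteq[n]$ and branches on $\bigoplus_{i\in S}x_i$; $\mathsf{PDT}(f)$ is the minimum depth of a parity decision tree computing $f$. $\deg(f)$ is the degree of the unique multilinear real polynomial agreeing with $f$ on $\{0,1\}^n$. For $B\subseteq[n]$, $x^{\oplus B}$ is $x$ with bits in $B$ flipped; $B$ is a sensitive block of $x$ if $f(x^{\oplus B})\ne f(x)$; $\mathrm{bs}(f)=\max_x$ (maximum number of pairwise disjoint sensitive blocks of $x$). $\mathrm{fbs}(f,x)$ is the maximum of $\sum_B w_B$ over weights $w_B\in[0,1]$ on the sensitive blocks $B$ of $x$ subject to $\sum_{B\ni i}w_B\le1$ for every $i$; $\mathrm{fbs}(f)=\max_x\mathrm{fbs}(f,x)$. -}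

module Defs where

open import Data.Nat using (ℕ; zero; suc; _+_; _*_; _^_; _⊔_) renaming (_≤_ to _≤ℕ_)
open import Data.Nat.Logarithm using (⌈log₂_⌉)
open import Data.Bool using (Bool; true; false; _xor_; _∧_; if_then_else_)
open import Data.Fin using (Fin)
open import Data.Vec using (Vec; []; _∷_; zipWith; foldr; lookup)
open import Data.List using (List; []; _∷_; map; length; filter)
import Data.List as L
open import Data.List.Relation.Unary.All using (All)
open import Data.List.Relation.Unary.AllPairs using (AllPairs)
open import Data.Fin.Subset using (Subset; _∩_; Empty; ∣_∣)
open import Data.Integer using (+_)
open import Data.Rational using (ℚ; 0ℚ; 1ℚ; _/_) renaming (_+_ to _+ℚ_; _*_ to _*ℚ_; _≤_ to _≤ℚ_)
open import Data.Rational.Properties using (_≟_)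
open import Data.Product using (Σ; ∃; _×_; _,_)
open import Relation.Binary.PropositionalEquality using (_≡_; _≢_)
open import Relation.Nullary using (¬_; yes; no)

-- An input x ∈ {0,1}^n (true = 1).
Input : ℕ → Set
Input n = Vec Bool n

BoolFn : ℕ → Set
BoolFn n = Input n → Bool

allVecs : (n : ℕ) → List (Vec Bool n)
allVecs zero = [] ∷ []
allVecs (suc n) = map (false ∷_) (allVecs n) L.++ map (true ∷_) (allVecs n)

flip : ∀ {n} → Input n → Subset n → Input n
flip x B = zipWith _xor_ x B

parity : ∀ {n} → Subset n → Input n → Bool
parity S x = foldr _ _xor_ false (zipWith _∧_ S x)

data DT (n : ℕ) : Set where
  leaf : Bool → DT n
  node : Fin n → DT n → DT n → DT n

evalDT : ∀ {n} → DT n → Input n → Bool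
evalDT (leaf b) x = b
evalDT (node i t₀ t₁) x = if lookup x i then evalDT t₁ x else evalDT t₀ x

depthDT : ∀ {n} → DT n → ℕ
depthDT (leaf _) = 0
depthDT (node _ t₀ t₁) = suc (depthDT t₀ ⊔ depthDT t₁)

rankCombine : ℕ → ℕ → ℕ
rankCombine r₁ r₂ with r₁ Data.Nat.≟ r₂
... | yes _ = suc r₁
... | no _ = r₁ ⊔ r₂
  where import Data.Nat

rankDT : ∀ {n} → DT n → ℕ
rankDT (leaf _) = 0
rankDT (node _ t₀ t₁) = rankCombine (rankDT t₀) (rankDT t₁)

ComputesDT : ∀ {n} → DT n → BoolFn n → Set
ComputesDT t f = ∀ x → evalDT t x ≡ f x

D≤ : ∀ {n} → BoolFn n → ℕ → Set
D≤ {n} f m = Σ (DT n) λ t → ComputesDT t f × depthDT t ≤ℕ m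

rank≤ : ∀ {n} → BoolFn n → ℕ → Set
rank≤ {n} f m = Σ (DT n) λ t → ComputesDT t f × rankDT t ≤ℕ m

data PDT (n : ℕ) : Set where
  pleaf : Bool → PDT n
  pnode : Subset n → PDT n → PDT n → PDT n

evalPDT : ∀ {n} → PDT n → Input n → Bool
evalPDT (pleaf b) x = b
evalPDT (pnode S t₀ t₁) x = if parity S x then evalPDT t₁ x else evalPDT t₀ x

depthPDT : ∀ {n} → PDT n → ℕ
depthPDT (pleaf _) = 0
depthPDT (pnode _ t₀ t₁) = suc (depthPDT t₀ ⊔ depthPDT t₁)

PDT≤ : ∀ {n} → BoolFn n → ℕ → Set
PDT≤ {n} f m = Σ (PDT n) λ t → (∀ x → evalPDT t x ≡ f x) × depthPDT t ≤ℕ m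

data Measure : Set where
  rankM pdtM : Measure

M≤ : Measure → ∀ {n} → BoolFn n → ℕ → Set
M≤ rankM f m = rank≤ f m
M≤ pdtM f m = PDT≤ f m

-- Degree: multilinear polynomials with rational coefficients
-- p S is the coefficient of the monomial ∏_{i∈S} x_i.

ℕtoℚ : ℕ → ℚ
ℕtoℚ k = + k / 1

boolToℚ : Bool → ℚ
boolToℚ true = 1ℚ
boolToℚ false = 0ℚ

sumℚ : List ℚ → ℚ
sumℚ = L.foldr _+ℚ_ 0ℚ

MultPoly : ℕ → Set
MultPoly n = Subset n → ℚ

monomial : ∀ {n} → Subset n → Input n → ℚ
monomial S x = foldr _ _*ℚ_ 1ℚ (zipWith (λ s b → if s then boolToℚ b else 1ℚ) S x)

evalPoly : ∀ {n} → MultPoly n → Input n → ℚ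
evalPoly {n} p x = sumℚ (map (λ S → p S *ℚ monomial S x) (allVecs n))

Represents : ∀ {n} → MultPoly n → BoolFn n → Set
Represents p f = ∀ x → evalPoly p x ≡ boolToℚ (f x)

-- degree: max |S| over monomials with nonzero coefficient (0 for the zero polynomial)
degPoly : ∀ {n} → MultPoly n → ℕ
degPoly {n} p = L.foldr (λ S acc → nz (p S ≟ 0ℚ) S acc) 0 (allVecs n)
  where
  nz : ∀ {A : Set} → Relation.Nullary.Dec A → Subset n → ℕ → ℕ
  nz (yes _) S acc = acc
  nz (no _) S acc = ∣ S ∣ ⊔ acc

SensitiveBlock : ∀ {n} → BoolFn n → Input n → Subset n → Set
SensitiveBlock f x B = f (flip x B) ≢ f x

Disjoint : ∀ {n} → Subset n → Subset n → Set
Disjoint p q = Empty (p ∩ q)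

DisjSensFamily : ∀ {n} → BoolFn n → Input n → List (Subset n) → Set
DisjSensFamily f x Bs = All (SensitiveBlock f x) Bs × AllPairs Disjoint Bs

IsBS : ∀ {n} → BoolFn n → ℕ → Set
IsBS {n} f b =
  (Σ (Input n) λ x → Σ (List (Subset n)) λ Bs → DisjSensFamily f x Bs × length Bs ≡ b)
  × (∀ x Bs → DisjSensFamily f x Bs → length Bs ≤ℕ b)

-- Fractional block sensitivity (weights indexed by all subsets; only
-- sensitive blocks may carry nonzero weight)

Weights : ℕ → Set
Weights n = Subset n → ℚ

totalWeight : ∀ {n} → Weights n → ℚ
totalWeight {n} w = sumℚ (map w (allVecs n))

weightAt : ∀ {n} → Weights n → Fin n → ℚ
weightAt {n} w i = sumℚ (map (λ B → if lookup B i then w B else 0ℚ) (allVecs n))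

Feasible : ∀ {n} → BoolFn n → Input n → Weights n → Set
Feasible {n} f x w =
  (∀ B → 0ℚ ≤ℚ w B) × (∀ B → w B ≤ℚ 1ℚ)
  × (∀ B → w B ≢ 0ℚ → SensitiveBlock f x B)
  × (∀ (i : Fin n) → weightAt w i ≤ℚ 1ℚ)

IsFBS : ∀ {n} → BoolFn n → ℚ → Set
IsFBS {n} f q =
  (Σ (Input n) λ x → Σ (Weights n) λ w → Feasible f x w × totalWeight w ≡ q)
  × (∀ x w → Feasible f x w → totalWeight w ≤ℚ q)

-- The two implications of the theorem, for a measure M.
-- Constants c, k > 0 are taken in ℕ and log n is ⌈log₂ n⌉.

Part1 : Measure → Set
Part1 M =
  (Σ ℕ λ c₁ → Σ ℕ λ k₁ → 1 ≤ℕ c₁ × 1 ≤ℕ k₁ ×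
     (∀ n → 2 ≤ℕ n → (f : BoolFn n) → (p : MultPoly n) → Represents p f →
        M≤ M f (c₁ * (degPoly p ^ 2) * (⌈log₂ n ⌉ ^ k₁))))
  → Σ ℕ λ c₂ → Σ ℕ λ k₂ → 1 ≤ℕ c₂ × 1 ≤ℕ k₂ ×
     (∀ n → 2 ≤ℕ n → (f : BoolFn n) → (p : MultPoly n) → Represents p f →
        D≤ f (c₂ * (degPoly p ^ 2) * (⌈log₂ n ⌉ ^ k₂)))

Part2 : Measure → Set
Part2 M =
  (Σ ℕ λ c₁ → Σ ℕ λ k₁ → 1 ≤ℕ c₁ × 1 ≤ℕ k₁ ×
     (∀ n → 2 ≤ℕ n → (f : BoolFn n) → (b : ℕ) → IsBS f b →
        M≤ M f (c₁ * (b ^ 2) * (⌈log₂ n ⌉ ^ k₁))))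
  → Σ ℕ λ c₂ → Σ ℕ λ k₂ → 1 ≤ℕ c₂ × 1 ≤ℕ k₂ ×
     (∀ n → 2 ≤ℕ n → (f : BoolFn n) → (q : ℚ) → IsFBS f q →
        Σ ℕ λ d → D≤ f d ×
          ℕtoℚ d ≤ℚ (ℕtoℚ c₂ *ℚ (q *ℚ q)) *ℚ ℕtoℚ (⌈log₂ n ⌉ ^ k₂))

{-# OPTIONS --safe #-}

-- Let F = f ∘ Maj₃ⁿ be f composed with the majority of three fresh variables in each
-- coordinate, a function of 3n variables, and apply the hypothesis to F. Three facts carry
-- the bound back to f.
-- (i) A parity decision tree for F gives a decision tree for f whose depth is at most the rank,
-- hence at most the depth, of the parity tree. At a query of a nonzero parity, pick a block j
-- the parity touches and query y_j instead; in each branch replace the bits of that block by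
-- affine functions of the other variables that keep its majority equal to y_j and force the
-- parity towards the child of smaller rank, and recurse.
-- (ii) deg F ≤ 3 deg f, since Maj₃ is a cubic polynomial.
-- (iii) bs F ≤ 2 fbs f: flipping a block B of a disjoint sensitive family of F at x changes
-- the majorities on a set of coordinates which is a sensitive block of f at the majorities of x.
-- Every coordinate lies in at most two of these sets, since changing a majority requires a flip
-- at one of two fixed positions of its triple, so weight ½ on each of them is feasible.
-- Finally ⌈log₂ 3n⌉ ≤ 3⌈log₂ n⌉ for n ≥ 2 only changes the constants.

module Submission where

open import Defs

open import Data.Bool using (Bool; true; false; _xor_; _∧_; _∨_; not; if_then_else_; T)
import Data.Bool.Properties as BoolP
open import Data.Bool.Solver using (module xor-∧-Solver)
open import Data.Empty using (⊥-elim)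
open import Data.Fin using (Fin; zero; suc)
import Data.Fin as Fin
import Data.Fin.Properties as FinP
open import Data.Fin.Subset using (Subset; ⊥; ⁅_⁆; ∣_∣; Nonempty; Empty; _∩_) renaming (_∈_ to _∈ˢ_)
import Data.Fin.Subset.Properties as SubsetP
import Data.Integer as ℤ
import Data.Integer.Properties as ℤP
open import Data.List using (List; _++_; length; cartesianProductWith)
  renaming ([] to []ˡ; _∷_ to _∷ˡ_; map to mapˡ; foldr to foldrˡ; lookup to lookupˡ)
open import Data.List.Membership.Propositional using (_∈_; lose)
import Data.List.Membership.Propositional.Properties as ∈P
import Data.List.Properties as ListP
open import Data.List.Relation.Unary.All using (All) renaming ([] to []ᵃ; _∷_ to _∷ᵃ_)
import Data.List.Relation.Unary.All as All
open import Data.List.Relation.Unary.AllPairs using (AllPairs) renaming ([] to []ᵖ; _∷_ to _∷ᵖ_)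
import Data.List.Relation.Unary.AllPairs as AllPairs
open import Data.List.Relation.Unary.Any using (here; there)
import Data.List.Relation.Unary.Any as Any
open import Data.Nat using (ℕ; zero; suc; _+_; _*_; _^_; _⊔_; _≤_; _<_; z≤n; s≤s; _≟_; _≤?_)
import Data.Nat.Coprimality as Coprimality
open import Data.Nat.Logarithm using (⌈log₂_⌉; ⌈log₂⌉-mono-≤; ⌈log₂2*n⌉≡1+⌈log₂n⌉)
import Data.Nat.Properties as ℕP
import Data.Nat.Solver as ℕSolver
open import Data.Product using (Σ; _×_; _,_; proj₁; proj₂)
open import Data.Rational using (ℚ; 0ℚ; 1ℚ; ½; -_; mkℚ; *≤*; nonNegative)
  renaming (_+_ to _+ℚ_; _*_ to _*ℚ_; _≤_ to _≤ℚ_)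
import Data.Rational.Properties as ℚP
import Data.Rational.Solver as ℚSolver
open import Data.Sum using (_⊎_; inj₁; inj₂)
open import Data.Vec using (Vec; []; _∷_; zipWith; lookup; map; replicate; tabulate; _[_]≔_)
  renaming (here to hereᵛ; there to thereᵛ)
import Data.Vec.Properties as VecP
open import Function using (_∘_; Equivalence)
open import Relation.Binary.PropositionalEquality
open import Relation.Nullary using (Dec; yes; no; ¬_)
open import Relation.Nullary.Decidable using (_×-dec_; ¬?; toWitness; does; dec-true; dec-false)

open xor-∧-Solver using (solve; _:=_; _:+_; _:*_; con)
open ℚSolver.+-*-Solver using ()
  renaming (solve to solveℚ; _:=_ to _:=ℚ_; _:+_ to _:+ℚ_; _:*_ to _:*ℚ_; con to conℚ)
open ℕSolver.+-*-Solver using ()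
  renaming (solve to solveℕ; _:=_ to _:=ℕ_; _:+_ to _:+ℕ_; _:*_ to _:*ℕ_; _:^_ to _:^ℕ_; con to conℕ)

private
  variable
    A : Set
    k m n : ℕ

-- Majority blocks

maj₃ : Vec Bool 3 → Bool
maj₃ (true ∷ b ∷ c ∷ []) = b ∨ c
maj₃ (false ∷ b ∷ c ∷ []) = b ∧ c

majorities : Vec Bool (n * 3) → Vec Bool n
majorities {zero} [] = []
majorities {suc n} (a ∷ b ∷ c ∷ x) = maj₃ (a ∷ b ∷ c ∷ []) ∷ majorities x

composeMaj : BoolFn n → BoolFn (n * 3)
composeMaj f = f ∘ majorities

triplicate : Vec Bool n → Vec Bool (n * 3)
triplicate [] = []
triplicate (b ∷ y) = b ∷ b ∷ b ∷ triplicate y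

blockAt : Vec A (n * 3) → Fin n → Vec A 3
blockAt {n = suc n} (a ∷ b ∷ c ∷ x) zero = a ∷ b ∷ c ∷ []
blockAt {n = suc n} (a ∷ b ∷ c ∷ x) (suc j) = blockAt x j

updateBlock : Vec A (n * 3) → Fin n → Vec A 3 → Vec A (n * 3)
updateBlock {n = suc n} (_ ∷ _ ∷ _ ∷ x) zero (a ∷ b ∷ c ∷ []) = a ∷ b ∷ c ∷ x
updateBlock {n = suc n} (a ∷ b ∷ c ∷ x) (suc j) u = a ∷ b ∷ c ∷ updateBlock x j u

clearBlock : Subset (n * 3) → Fin n → Subset (n * 3)
clearBlock S j = updateBlock S j ⊥

maj₃-triple : ∀ b → maj₃ (b ∷ b ∷ b ∷ []) ≡ b
maj₃-triple true = refl
maj₃-triple false = refl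

maj₃-outvoted : ∀ k v z → maj₃ (replicate 3 v [ k ]≔ z) ≡ v
maj₃-outvoted zero v true = BoolP.∨-idem v
maj₃-outvoted zero v false = BoolP.∧-idem v
maj₃-outvoted (suc zero) true z = BoolP.∨-zeroʳ z
maj₃-outvoted (suc zero) false z = BoolP.∧-zeroʳ z
maj₃-outvoted (suc (suc zero)) true z = refl
maj₃-outvoted (suc (suc zero)) false z = refl

majorities-triplicate : (y : Vec Bool n) → majorities (triplicate y) ≡ y
majorities-triplicate [] = refl
majorities-triplicate (b ∷ y) = cong₂ _∷_ (maj₃-triple b) (majorities-triplicate y)

majorities-updateBlock : (x : Vec Bool (n * 3)) (j : Fin n) (u : Vec Bool 3) →
  majorities (updateBlock x j u) ≡ majorities x [ j ]≔ maj₃ u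
majorities-updateBlock {suc n} (_ ∷ _ ∷ _ ∷ x) zero (a ∷ b ∷ c ∷ []) = refl
majorities-updateBlock {suc n} (a ∷ b ∷ c ∷ x) (suc j) u =
  cong (maj₃ (a ∷ b ∷ c ∷ []) ∷_) (majorities-updateBlock x j u)

map-updateBlock : (g : A → Bool) (x : Vec A (n * 3)) (j : Fin n) (u : Vec A 3) →
  map g (updateBlock x j u) ≡ updateBlock (map g x) j (map g u)
map-updateBlock {n = suc n} g (_ ∷ _ ∷ _ ∷ x) zero (a ∷ b ∷ c ∷ []) = refl
map-updateBlock {n = suc n} g (a ∷ b ∷ c ∷ x) (suc j) u =
  cong (λ z → g a ∷ g b ∷ g c ∷ z) (map-updateBlock g x j u)

lookup-majorities : (x : Vec Bool (n * 3)) (j : Fin n) → lookup (majorities x) j ≡ maj₃ (blockAt x j)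
lookup-majorities {suc n} (a ∷ b ∷ c ∷ x) zero = refl
lookup-majorities {suc n} (a ∷ b ∷ c ∷ x) (suc j) = lookup-majorities x j

blockAt-zipWith : (g : Bool → Bool → Bool) (x y : Vec Bool (n * 3)) (j : Fin n) →
  blockAt (zipWith g x y) j ≡ zipWith g (blockAt x j) (blockAt y j)
blockAt-zipWith {suc n} g (a ∷ b ∷ c ∷ x) (a′ ∷ b′ ∷ c′ ∷ y) zero = refl
blockAt-zipWith {suc n} g (a ∷ b ∷ c ∷ x) (a′ ∷ b′ ∷ c′ ∷ y) (suc j) = blockAt-zipWith g x y j

blockIndex : Fin n → Fin 3 → Fin (n * 3)
blockIndex {suc n} zero zero = zero
blockIndex {suc n} zero (suc zero) = suc zero
blockIndex {suc n} zero (suc (suc zero)) = suc (suc zero)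
blockIndex {suc n} (suc j) k = suc (suc (suc (blockIndex j k)))

lookup-blockAt : (x : Vec A (n * 3)) (j : Fin n) (k : Fin 3) → lookup (blockAt x j) k ≡ lookup x (blockIndex j k)
lookup-blockAt {n = suc n} (a ∷ b ∷ c ∷ x) zero zero = refl
lookup-blockAt {n = suc n} (a ∷ b ∷ c ∷ x) zero (suc zero) = refl
lookup-blockAt {n = suc n} (a ∷ b ∷ c ∷ x) zero (suc (suc zero)) = refl
lookup-blockAt {n = suc n} (a ∷ b ∷ c ∷ x) (suc j) k = lookup-blockAt x j k

parity-⊥ : (x : Input m) → parity ⊥ x ≡ false
parity-⊥ [] = refl
parity-⊥ (_ ∷ x) = parity-⊥ x

parity-⁅⁆ : (i : Fin m) (x : Input m) → parity ⁅ i ⁆ x ≡ lookup x i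
parity-⁅⁆ zero (b ∷ x) rewrite parity-⊥ x = BoolP.xor-identityʳ b
parity-⁅⁆ (suc i) (_ ∷ x) = parity-⁅⁆ i x

parity-xor : (S T : Subset m) (x : Input m) →
  parity (zipWith _xor_ S T) x ≡ parity S x xor parity T x
parity-xor [] [] [] = refl
parity-xor (s ∷ S) (t ∷ T) (b ∷ x) rewrite parity-xor S T x =
  solve 5 (λ s t b p q → (s :+ t) :* b :+ (p :+ q) := (s :* b :+ p) :+ (t :* b :+ q))
    refl s t b (parity S x) (parity T x)

parity-[]≔ : (S : Subset m) (x : Input m) (i : Fin m) (z : Bool) →
  parity S (x [ i ]≔ z) ≡ parity S (x [ i ]≔ false) xor (lookup S i ∧ z)
parity-[]≔ (s ∷ S) (b ∷ x) zero z rewrite BoolP.∧-zeroʳ s = BoolP.xor-comm (s ∧ z) (parity S x)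
parity-[]≔ (s ∷ S) (b ∷ x) (suc i) z rewrite parity-[]≔ S x i z =
  sym (BoolP.xor-assoc (s ∧ b) (parity S (x [ i ]≔ false)) (lookup S i ∧ z))

parity-updateBlock : (S x : Vec Bool (n * 3)) (j : Fin n) (u : Vec Bool 3) →
  parity S (updateBlock x j u) ≡ parity (clearBlock S j) x xor parity (blockAt S j) u
parity-updateBlock {suc n} (s₀ ∷ s₁ ∷ s₂ ∷ S) (_ ∷ _ ∷ _ ∷ x) zero (a ∷ b ∷ c ∷ []) =
  solve 7 (λ s₀ s₁ s₂ a b c p → s₀ :* a :+ (s₁ :* b :+ (s₂ :* c :+ p))
                               := p :+ (s₀ :* a :+ (s₁ :* b :+ (s₂ :* c :+ con false))))
    refl s₀ s₁ s₂ a b c (parity S x)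
parity-updateBlock {suc n} (s₀ ∷ s₁ ∷ s₂ ∷ S) (a ∷ b ∷ c ∷ x) (suc j) u
  rewrite parity-updateBlock S x j u =
  solve 5 (λ p q r P Q → p :+ (q :+ (r :+ (P :+ Q))) := (p :+ (q :+ (r :+ P))) :+ Q)
    refl (s₀ ∧ a) (s₁ ∧ b) (s₂ ∧ c) (parity (clearBlock S j) x) (parity (blockAt S j) u)

-- Affine substitutions in parity decision trees

record Affine (m : ℕ) : Set where
  constructor affine
  field
    constant : Bool
    support : Subset m

⟦_⟧ : Affine m → Input m → Bool
⟦ affine c S ⟧ x = c xor parity S x

evalAll : Vec (Affine m) k → Input m → Vec Bool k
evalAll αs x = map (λ α → ⟦ α ⟧ x) αs

_⊕_ : Affine m → Affine m → Affine m
affine c S ⊕ affine d T = affine (c xor d) (zipWith _xor_ S T)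

⟦⊕⟧ : (α β : Affine m) (x : Input m) → ⟦ α ⊕ β ⟧ x ≡ ⟦ α ⟧ x xor ⟦ β ⟧ x
⟦⊕⟧ (affine c S) (affine d T) x rewrite parity-xor S T x =
  solve 4 (λ c d p q → (c :+ d) :+ (p :+ q) := (c :+ p) :+ (d :+ q)) refl c d (parity S x) (parity T x)

⟦const⟧ : (b : Bool) (x : Input m) → ⟦ affine b ⊥ ⟧ x ≡ b
⟦const⟧ b x rewrite parity-⊥ x = BoolP.xor-identityʳ b

combination : Subset k → Vec (Affine m) k → Affine m
combination [] [] = affine false ⊥
combination (true ∷ S) (α ∷ αs) = α ⊕ combination S αs
combination (false ∷ S) (_ ∷ αs) = combination S αs

⟦combination⟧ : (S : Subset k) (αs : Vec (Affine m) k) (x : Input m) →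
  ⟦ combination S αs ⟧ x ≡ parity S (evalAll αs x)
⟦combination⟧ [] [] x = ⟦const⟧ false x
⟦combination⟧ (true ∷ S) (α ∷ αs) x =
  trans (⟦⊕⟧ α (combination S αs) x) (cong (⟦ α ⟧ x xor_) (⟦combination⟧ S αs x))
⟦combination⟧ (false ∷ S) (_ ∷ αs) x = ⟦combination⟧ S αs x

variables : Vec (Affine m) m
variables = tabulate (λ i → affine false ⁅ i ⁆)

evalAll-variables : (x : Input m) → evalAll variables x ≡ x
evalAll-variables x = begin
  map (λ α → ⟦ α ⟧ x) (tabulate (λ i → affine false ⁅ i ⁆)) ≡⟨ VecP.tabulate-∘ _ _ ⟨
  tabulate (λ i → parity ⁅ i ⁆ x)                          ≡⟨ VecP.tabulate-cong (λ i → parity-⁅⁆ i x) ⟩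
  tabulate (lookup x)                                      ≡⟨ VecP.tabulate∘lookup x ⟩
  x                                                        ∎
  where open ≡-Reasoning

branch : Affine m → PDT m → PDT m → PDT m
branch (affine false S) t₀ t₁ = pnode S t₀ t₁
branch (affine true S) t₀ t₁ = pnode S t₁ t₀

evalPDT-branch : (α : Affine m) (t₀ t₁ : PDT m) (x : Input m) →
  evalPDT (branch α t₀ t₁) x ≡ (if ⟦ α ⟧ x then evalPDT t₁ x else evalPDT t₀ x)
evalPDT-branch (affine false S) t₀ t₁ x = refl
evalPDT-branch (affine true S) t₀ t₁ x with parity S x
... | true = refl
... | false = refl

substitute : Vec (Affine m) n → PDT n → PDT m
substitute σ (pleaf b) = pleaf b
substitute σ (pnode S t₀ t₁) = branch (combination S σ) (substitute σ t₀) (substitute σ t₁)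

evalPDT-substitute : (σ : Vec (Affine m) n) (t : PDT n) (x : Input m) →
  evalPDT (substitute σ t) x ≡ evalPDT t (evalAll σ x)
evalPDT-substitute σ (pleaf b) x = refl
evalPDT-substitute σ (pnode S t₀ t₁) x
  rewrite evalPDT-branch (combination S σ) (substitute σ t₀) (substitute σ t₁) x
        | ⟦combination⟧ S σ x | evalPDT-substitute σ t₀ x | evalPDT-substitute σ t₁ x = refl

rankPDT : PDT m → ℕ
rankPDT (pleaf _) = 0
rankPDT (pnode _ t₀ t₁) = rankCombine (rankPDT t₀) (rankPDT t₁)

rankCombine-comm : ∀ r s → rankCombine r s ≡ rankCombine s r
rankCombine-comm r s with r ≟ s | s ≟ r
... | yes refl | yes _ = refl
... | yes r≡s | no s≢r = ⊥-elim (s≢r (sym r≡s))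
... | no r≢s | yes s≡r = ⊥-elim (r≢s (sym s≡r))
... | no _ | no _ = ℕP.⊔-comm r s

rankCombine≤suc⊔ : ∀ r s → rankCombine r s ≤ suc (r ⊔ s)
rankCombine≤suc⊔ r s with r ≟ s
... | yes _ = s≤s (ℕP.m≤m⊔n r s)
... | no _ = ℕP.n≤1+n (r ⊔ s)

rankCombine-≥ˡ : ∀ r s → r ≤ rankCombine r s
rankCombine-≥ˡ r s with r ≟ s
... | yes _ = ℕP.n≤1+n r
... | no _ = ℕP.m≤m⊔n r s

rankCombine->ˡ : ∀ r s → r ≤ s → r < rankCombine r s
rankCombine->ˡ r s r≤s with r ≟ s
... | yes _ = ℕP.n<1+n r
... | no r≢s = ℕP.<-≤-trans (ℕP.≤∧≢⇒< r≤s r≢s) (ℕP.m≤n⊔m r s)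

rankPDT≤depthPDT : (t : PDT m) → rankPDT t ≤ depthPDT t
rankPDT≤depthPDT (pleaf _) = z≤n
rankPDT≤depthPDT (pnode _ t₀ t₁) = ℕP.≤-trans (rankCombine≤suc⊔ (rankPDT t₀) (rankPDT t₁))
  (s≤s (ℕP.⊔-mono-≤ (rankPDT≤depthPDT t₀) (rankPDT≤depthPDT t₁)))

child : Bool → PDT m → PDT m → PDT m
child b t₀ t₁ = if b then t₁ else t₀

lowerRankChild : (t₀ t₁ : PDT m) →
  Σ Bool λ b → rankPDT (child b t₀ t₁) < rankCombine (rankPDT t₀) (rankPDT t₁)
lowerRankChild t₀ t₁ with rankPDT t₀ ≤? rankPDT t₁
... | yes r₀≤r₁ = false , rankCombine->ˡ _ _ r₀≤r₁
... | no r₀≰r₁ = true , subst (rankPDT t₁ <_) (rankCombine-comm (rankPDT t₁) (rankPDT t₀))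
                          (rankCombine->ˡ _ _ (ℕP.<⇒≤ (ℕP.≰⇒> r₀≰r₁)))

depthPDT-child : (b : Bool) (t₀ t₁ : PDT m) → depthPDT (child b t₀ t₁) ≤ depthPDT t₀ ⊔ depthPDT t₁
depthPDT-child false t₀ t₁ = ℕP.m≤m⊔n _ _
depthPDT-child true t₀ t₁ = ℕP.m≤n⊔m _ _

evalPDT-⊥-node : (t₀ t₁ : PDT m) (x : Input m) → evalPDT (pnode ⊥ t₀ t₁) x ≡ evalPDT t₀ x
evalPDT-⊥-node t₀ t₁ x rewrite parity-⊥ x = refl

evalPDT-child : (S : Subset m) (t₀ t₁ : PDT m) (x : Input m) →
  evalPDT (pnode S t₀ t₁) x ≡ evalPDT (child (parity S x) t₀ t₁) x
evalPDT-child S t₀ t₁ x with parity S x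
... | true = refl
... | false = refl

depthPDT-substitute : (σ : Vec (Affine m) n) (t : PDT n) → depthPDT (substitute σ t) ≡ depthPDT t
depthPDT-substitute σ (pleaf _) = refl
depthPDT-substitute σ (pnode S t₀ t₁) with combination S σ
... | affine false _ = cong₂ (λ d e → suc (d ⊔ e)) (depthPDT-substitute σ t₀) (depthPDT-substitute σ t₁)
... | affine true _ = trans (cong suc (ℕP.⊔-comm (depthPDT (substitute σ t₁)) _))
                        (cong₂ (λ d e → suc (d ⊔ e)) (depthPDT-substitute σ t₀) (depthPDT-substitute σ t₁))

rankPDT-substitute : (σ : Vec (Affine m) n) (t : PDT n) → rankPDT (substitute σ t) ≡ rankPDT t
rankPDT-substitute σ (pleaf _) = refl
rankPDT-substitute σ (pnode S t₀ t₁) with combination S σ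
... | affine false _ = cong₂ rankCombine (rankPDT-substitute σ t₀) (rankPDT-substitute σ t₁)
... | affine true _ = trans (rankCombine-comm (rankPDT (substitute σ t₁)) _)
                        (cong₂ rankCombine (rankPDT-substitute σ t₀) (rankPDT-substitute σ t₁))

-- Simulating a parity decision tree for f ∘ Maj₃ by a decision tree for f

Pivot : Subset (n * 3) → Set
Pivot {n} S = Σ (Fin n) λ j → Σ (Fin 3) λ k → lookup (blockAt S j) k ≡ true

emptyOrPivot : (S : Subset (n * 3)) → S ≡ ⊥ ⊎ Pivot {n} S
emptyOrPivot {zero} [] = inj₁ refl
emptyOrPivot {suc n} (true ∷ _ ∷ _ ∷ _) = inj₂ (zero , zero , refl)
emptyOrPivot {suc n} (false ∷ true ∷ _ ∷ _) = inj₂ (zero , suc zero , refl)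
emptyOrPivot {suc n} (false ∷ false ∷ true ∷ _) = inj₂ (zero , suc (suc zero) , refl)
emptyOrPivot {suc n} (false ∷ false ∷ false ∷ S) with emptyOrPivot {n} S
... | inj₁ refl = inj₁ refl
... | inj₂ (j , k , hit) = inj₂ (suc j , k , hit)

-- The block becomes (v, v, z) up to order, with z in the pivot position chosen
-- to force the query S to answer b; its majority stays v.
forcingForm : Subset (n * 3) → Fin n → Fin 3 → (b v : Bool) → Affine (n * 3)
forcingForm S j k b v = affine (b xor parity (blockAt S j) (replicate 3 v [ k ]≔ false)) (clearBlock S j)

pivotBlock : Subset (n * 3) → Fin n → Fin 3 → (b v : Bool) → Vec (Affine (n * 3)) 3
pivotBlock S j k b v = replicate 3 (affine v ⊥) [ k ]≔ forcingForm S j k b v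

evalAll-pivotBlock : (S : Subset (n * 3)) (j : Fin n) (k : Fin 3) (b v : Bool) (x : Input (n * 3)) →
  evalAll (pivotBlock S j k b v) x ≡ replicate 3 v [ k ]≔ ⟦ forcingForm S j k b v ⟧ x
evalAll-pivotBlock S j k b v x =
  trans (VecP.map-[]≔ (λ α → ⟦ α ⟧ x) (replicate 3 (affine v ⊥)) k)
        (cong (λ u → u [ k ]≔ ⟦ forcingForm S j k b v ⟧ x)
              (trans (VecP.map-replicate (λ α → ⟦ α ⟧ x) (affine v ⊥) 3) (cong (replicate 3) (⟦const⟧ v x))))

maj₃-pivotBlock : (S : Subset (n * 3)) (j : Fin n) (k : Fin 3) (b v : Bool) (x : Input (n * 3)) →
  maj₃ (evalAll (pivotBlock S j k b v) x) ≡ v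
maj₃-pivotBlock {n} S j k b v x = trans (cong maj₃ (evalAll-pivotBlock {n} S j k b v x)) (maj₃-outvoted k v _)

parity-pivotBlock : (S : Subset (n * 3)) (j : Fin n) (k : Fin 3) (b v : Bool) (x : Input (n * 3)) →
  lookup (blockAt S j) k ≡ true → parity S (updateBlock x j (evalAll (pivotBlock S j k b v) x)) ≡ b
parity-pivotBlock {n} S j k b v x hit = begin
  parity S (updateBlock x j (evalAll (pivotBlock S j k b v) x))
    ≡⟨ parity-updateBlock S x j (evalAll (pivotBlock S j k b v) x) ⟩
  C xor parity (blockAt S j) (evalAll (pivotBlock S j k b v) x)
    ≡⟨ cong (λ u → C xor parity (blockAt S j) u) (evalAll-pivotBlock {n} S j k b v x) ⟩
  C xor parity (blockAt S j) (replicate 3 v [ k ]≔ z)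
    ≡⟨ cong (C xor_) (parity-[]≔ (blockAt S j) (replicate 3 v) k z) ⟩
  C xor (P xor (lookup (blockAt S j) k ∧ z))
    ≡⟨ cong (λ h → C xor (P xor (h ∧ z))) hit ⟩
  C xor (P xor z)
    ≡⟨ solve 3 (λ C P b → C :+ (P :+ ((b :+ P) :+ C)) := b) refl C P b ⟩
  b ∎
  where
  open ≡-Reasoning
  C = parity (clearBlock S j) x
  P = parity (blockAt S j) (replicate 3 v [ k ]≔ false)
  z = ⟦ forcingForm S j k b v ⟧ x

ComputesPDT : PDT m → BoolFn m → Set
ComputesPDT t f = ∀ x → evalPDT t x ≡ f x

restrictBlock : Subset (n * 3) → Fin n → Fin 3 → (b v : Bool) → PDT (n * 3) → PDT (n * 3)
restrictBlock S j k b v = substitute (updateBlock variables j (pivotBlock S j k b v))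

evalPDT-restrictBlock : (S : Subset (n * 3)) (j : Fin n) (k : Fin 3) (b v : Bool) (t : PDT (n * 3)) (x : Input (n * 3)) →
  evalPDT (restrictBlock S j k b v t) x ≡ evalPDT t (updateBlock x j (evalAll (pivotBlock S j k b v) x))
evalPDT-restrictBlock S j k b v t x =
  trans (evalPDT-substitute (updateBlock variables j αs) t x)
        (cong (evalPDT t) (trans (map-updateBlock (λ α → ⟦ α ⟧ x) variables j αs)
                                 (cong (λ y → updateBlock y j (evalAll αs x)) (evalAll-variables x))))
  where αs = pivotBlock S j k b v

restrictBlock-computes : (f : BoolFn n) (S : Subset (n * 3)) (t₀ t₁ : PDT (n * 3)) →
  ComputesPDT (pnode S t₀ t₁) (composeMaj f) → (j : Fin n) (k : Fin 3) → lookup (blockAt S j) k ≡ true →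
  ∀ b v → ComputesPDT (restrictBlock S j k b v (child b t₀ t₁)) (composeMaj (λ y → f (y [ j ]≔ v)))
restrictBlock-computes f S t₀ t₁ t≈ j k hit b v x = begin
  evalPDT (restrictBlock S j k b v (child b t₀ t₁)) x
    ≡⟨ evalPDT-restrictBlock S j k b v (child b t₀ t₁) x ⟩
  evalPDT (child b t₀ t₁) x′
    ≡⟨ cong (λ p → evalPDT (child p t₀ t₁) x′) (parity-pivotBlock S j k b v x hit) ⟨
  evalPDT (child (parity S x′) t₀ t₁) x′
    ≡⟨ evalPDT-child S t₀ t₁ x′ ⟨
  evalPDT (pnode S t₀ t₁) x′
    ≡⟨ t≈ x′ ⟩
  f (majorities x′)
    ≡⟨ cong f (majorities-updateBlock x j (evalAll αs x)) ⟩
  f (majorities x [ j ]≔ maj₃ (evalAll αs x))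
    ≡⟨ cong (λ u → f (majorities x [ j ]≔ u)) (maj₃-pivotBlock S j k b v x) ⟩
  f (majorities x [ j ]≔ v) ∎
  where
  open ≡-Reasoning
  αs = pivotBlock S j k b v
  x′ = updateBlock x j (evalAll αs x)

branch-on-block : {f : BoolFn m} (j : Fin m) (D₀ D₁ : DT m) →
  ComputesDT D₀ (λ y → f (y [ j ]≔ false)) → ComputesDT D₁ (λ y → f (y [ j ]≔ true)) →
  ComputesDT (node j D₀ D₁) f
branch-on-block {f = f} j D₀ D₁ D₀≈ D₁≈ y with lookup y j in yⱼ
... | true = trans (D₁≈ y) (cong f (trans (cong (y [ j ]≔_) (sym yⱼ)) (VecP.[]≔-lookup y j)))
... | false = trans (D₀≈ y) (cong f (trans (cong (y [ j ]≔_) (sym yⱼ)) (VecP.[]≔-lookup y j)))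

-- Recursion on a depth bound d, since restricting a subtree does not make it structurally smaller.
simulate : ∀ d (f : BoolFn n) (t : PDT (n * 3)) → ComputesPDT t (composeMaj f) → depthPDT t ≤ d →
  Σ (DT n) λ D → ComputesDT D f × depthDT D ≤ rankPDT t
simulate d f (pleaf b) t≈ _ =
  leaf b , (λ y → trans (t≈ (triplicate y)) (cong f (majorities-triplicate y))) , z≤n
simulate {n} (suc d) f (pnode S t₀ t₁) t≈ (s≤s depth≤d) with emptyOrPivot {n} S
... | inj₁ refl =
  let (D , D≈ , depth≤rank) = simulate d f t₀ (λ x → trans (sym (evalPDT-⊥-node t₀ t₁ x)) (t≈ x))
                                           (ℕP.≤-trans (ℕP.m≤m⊔n _ _) depth≤d)
  in D , D≈ , ℕP.≤-trans depth≤rank (rankCombine-≥ˡ _ _)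
... | inj₂ (j , k , hit) =
  node j (D false) (D true) ,
  branch-on-block j (D false) (D true) (D≈ false) (D≈ true) ,
  ℕP.≤-trans (s≤s (ℕP.⊔-lub (D-depth false) (D-depth true))) (proj₂ (lowerRankChild t₀ t₁))
  where
  b = proj₁ (lowerRankChild t₀ t₁)
  tᵇ = child b t₀ t₁
  restriction : ∀ v → Σ (DT n) λ D → ComputesDT D (λ y → f (y [ j ]≔ v)) × depthDT D ≤ rankPDT tᵇ
  restriction v =
    let (D , D≈ , depth≤rank) =
          simulate d _ (restrictBlock S j k b v tᵇ) (restrictBlock-computes f S t₀ t₁ t≈ j k hit b v)
            (subst (_≤ d) (sym (depthPDT-substitute _ tᵇ)) (ℕP.≤-trans (depthPDT-child b t₀ t₁) depth≤d))
    in D , D≈ , subst (depthDT D ≤_) (rankPDT-substitute _ tᵇ) depth≤rank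
  D : Bool → DT n
  D v = proj₁ (restriction v)
  D≈ : ∀ v → ComputesDT (D v) (λ y → f (y [ j ]≔ v))
  D≈ v = proj₁ (proj₂ (restriction v))
  D-depth : ∀ v → depthDT (D v) ≤ rankPDT tᵇ
  D-depth v = proj₂ (proj₂ (restriction v))

toPDT : DT m → PDT m
toPDT (leaf b) = pleaf b
toPDT (node i t₀ t₁) = pnode ⁅ i ⁆ (toPDT t₀) (toPDT t₁)

evalPDT-toPDT : (t : DT m) (x : Input m) → evalPDT (toPDT t) x ≡ evalDT t x
evalPDT-toPDT (leaf b) x = refl
evalPDT-toPDT (node i t₀ t₁) x rewrite parity-⁅⁆ i x | evalPDT-toPDT t₀ x | evalPDT-toPDT t₁ x = refl

rankPDT-toPDT : (t : DT m) → rankPDT (toPDT t) ≡ rankDT t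
rankPDT-toPDT (leaf b) = refl
rankPDT-toPDT (node i t₀ t₁) = cong₂ rankCombine (rankPDT-toPDT t₀) (rankPDT-toPDT t₁)

D≤-from-composeMaj : ∀ M (f : BoolFn n) d → M≤ M (composeMaj f) d → D≤ f d
D≤-from-composeMaj rankM f d (t , t≈ , rank≤d) =
  let (D , D≈ , depth≤rank) = simulate _ f (toPDT t) (λ x → trans (evalPDT-toPDT t x) (t≈ x)) ℕP.≤-refl
  in D , D≈ , ℕP.≤-trans depth≤rank (subst (_≤ d) (sym (rankPDT-toPDT t)) rank≤d)
D≤-from-composeMaj pdtM f d (t , t≈ , depth≤d) =
  let (D , D≈ , depth≤rank) = simulate _ f t t≈ ℕP.≤-refl
  in D , D≈ , ℕP.≤-trans depth≤rank (ℕP.≤-trans (rankPDT≤depthPDT t) depth≤d)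

-- Degree of f ∘ Maj₃

sumℚ-++ : (ps qs : List ℚ) → sumℚ (ps ++ qs) ≡ sumℚ ps +ℚ sumℚ qs
sumℚ-++ []ˡ qs = sym (ℚP.+-identityˡ (sumℚ qs))
sumℚ-++ (p ∷ˡ ps) qs rewrite sumℚ-++ ps qs = sym (ℚP.+-assoc p (sumℚ ps) (sumℚ qs))

sumℚ-cong : {F G : A → ℚ} (xs : List A) → (∀ a → F a ≡ G a) → sumℚ (mapˡ F xs) ≡ sumℚ (mapˡ G xs)
sumℚ-cong xs F≗G = cong sumℚ (ListP.map-cong F≗G xs)

sumℚ-scale : (c : ℚ) (F : A → ℚ) (xs : List A) → sumℚ (mapˡ (λ a → c *ℚ F a) xs) ≡ c *ℚ sumℚ (mapˡ F xs)
sumℚ-scale c F []ˡ = sym (ℚP.*-zeroʳ c)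
sumℚ-scale c F (a ∷ˡ xs) rewrite sumℚ-scale c F xs = sym (ℚP.*-distribˡ-+ c (F a) (sumℚ (mapˡ F xs)))

sumℚ-zero : (F : A → ℚ) (as : List A) → (∀ a → F a ≡ 0ℚ) → sumℚ (mapˡ F as) ≡ 0ℚ
sumℚ-zero F []ˡ F≡0 = refl
sumℚ-zero F (a ∷ˡ as) F≡0 rewrite F≡0 a | sumℚ-zero F as F≡0 = refl

sumℚ-+ : (F G : A → ℚ) (as : List A) →
  sumℚ (mapˡ (λ a → F a +ℚ G a) as) ≡ sumℚ (mapˡ F as) +ℚ sumℚ (mapˡ G as)
sumℚ-+ F G []ˡ = refl
sumℚ-+ F G (a ∷ˡ as) rewrite sumℚ-+ F G as =
  solveℚ 4 (λ f g s t → (f :+ℚ g) :+ℚ (s :+ℚ t) :=ℚ (f :+ℚ s) :+ℚ (g :+ℚ t)) refl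
    (F a) (G a) (sumℚ (mapˡ F as)) (sumℚ (mapˡ G as))

sumℚ-allVecs-suc : (F : Vec Bool (suc m) → ℚ) →
  sumℚ (mapˡ F (allVecs (suc m)))
    ≡ sumℚ (mapˡ (λ S → F (false ∷ S)) (allVecs m)) +ℚ sumℚ (mapˡ (λ S → F (true ∷ S)) (allVecs m))
sumℚ-allVecs-suc {m} F
  rewrite ListP.map-++ F (mapˡ (false ∷_) (allVecs m)) (mapˡ (true ∷_) (allVecs m))
        | sumℚ-++ (mapˡ F (mapˡ (false ∷_) (allVecs m))) (mapˡ F (mapˡ (true ∷_) (allVecs m)))
        | sym (ListP.map-∘ {g = F} {f = false ∷_} (allVecs m))
        | sym (ListP.map-∘ {g = F} {f = true ∷_} (allVecs m)) = refl

interpolate : (Bool → ℚ) → ℚ → ℚ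
interpolate e a = e false +ℚ a *ℚ e true

interpolate-cong : {e e′ : Bool → ℚ} (a : ℚ) → (∀ u → e u ≡ e′ u) → interpolate e a ≡ interpolate e′ a
interpolate-cong a e≗e′ = cong₂ (λ p q → p +ℚ a *ℚ q) (e≗e′ false) (e≗e′ true)

evalPoly-cons : (p : MultPoly (suc m)) (v : Bool) (x : Input m) →
  evalPoly p (v ∷ x) ≡ interpolate (λ u → evalPoly (λ S → p (u ∷ S)) x) (boolToℚ v)
evalPoly-cons {m} p v x = begin
  evalPoly p (v ∷ x)
    ≡⟨ sumℚ-allVecs-suc (λ S → p S *ℚ monomial S (v ∷ x)) ⟩
  sumℚ (mapˡ (λ S → p (false ∷ S) *ℚ (1ℚ *ℚ monomial S x)) (allVecs m))
    +ℚ sumℚ (mapˡ (λ S → p (true ∷ S) *ℚ (boolToℚ v *ℚ monomial S x)) (allVecs m))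
    ≡⟨ cong₂ _+ℚ_ (sumℚ-cong (allVecs m) (λ S → cong (p (false ∷ S) *ℚ_) (ℚP.*-identityˡ (monomial S x))))
                  (trans (sumℚ-cong (allVecs m) (λ S → swap (p (true ∷ S)) (boolToℚ v) (monomial S x)))
                         (sumℚ-scale (boolToℚ v) (λ S → p (true ∷ S) *ℚ monomial S x) (allVecs m))) ⟩
  interpolate (λ u → evalPoly (λ S → p (u ∷ S)) x) (boolToℚ v) ∎
  where
  open ≡-Reasoning
  swap : ∀ a b c → a *ℚ (b *ℚ c) ≡ b *ℚ (a *ℚ c)
  swap a b c = trans (sym (ℚP.*-assoc a b c)) (trans (cong (_*ℚ c) (ℚP.*-comm a b)) (ℚP.*-assoc b a c))

evalPoly-scale : (c : ℚ) (p : MultPoly m) (x : Input m) →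
  evalPoly (λ S → c *ℚ p S) x ≡ c *ℚ evalPoly p x
evalPoly-scale {m} c p x = trans (sumℚ-cong (allVecs m) (λ S → ℚP.*-assoc c (p S) (monomial S x)))
                                 (sumℚ-scale c (λ S → p S *ℚ monomial S x) (allVecs m))

-- Write p = p₀ + y p₁ in the first variable y and substitute y = Maj₃(x₁, x₂, x₃) =
-- x₁x₂ + x₁x₃ + x₂x₃ − 2x₁x₂x₃: the monomial x₁ᵃx₂ᵇx₃ᶜ picks up the coefficient
-- majCoefficient a b c from p₀ when a = b = c = 0 and from p₁ otherwise.
majCoefficient : Bool → Bool → Bool → ℚ
majCoefficient false false false = 1ℚ
majCoefficient true false false = 0ℚ
majCoefficient false true false = 0ℚ
majCoefficient false false true = 0ℚ
majCoefficient true true false = 1ℚ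
majCoefficient true false true = 1ℚ
majCoefficient false true true = 1ℚ
majCoefficient true true true = - ℕtoℚ 2

composeMajPoly : MultPoly n → MultPoly (n * 3)
composeMajPoly {zero} p [] = p []
composeMajPoly {suc n} p (a ∷ b ∷ c ∷ T) = majCoefficient a b c *ℚ composeMajPoly (λ S → p ((a ∨ b ∨ c) ∷ S)) T

majPolynomial : ℚ → ℚ → ℚ → ℚ
majPolynomial a b c = ((a *ℚ b +ℚ a *ℚ c) +ℚ b *ℚ c) +ℚ (- ℕtoℚ 2) *ℚ (a *ℚ (b *ℚ c))

-- The solver needs the left-hand side spelled out: it is the nested interpolation in normal form.
majority-expansion : ∀ A B C G₀ G₁ →
  interpolate (λ u → interpolate (λ v → interpolate (λ w →
      majCoefficient u v w *ℚ (if u ∨ v ∨ w then G₁ else G₀)) C) B) A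
    ≡ G₀ +ℚ majPolynomial A B C *ℚ G₁
majority-expansion = solveℚ 5 (λ A B C G₀ G₁ →
  ((conℚ 1ℚ :*ℚ G₀ :+ℚ C :*ℚ (conℚ 0ℚ :*ℚ G₁))
     :+ℚ B :*ℚ (conℚ 0ℚ :*ℚ G₁ :+ℚ C :*ℚ (conℚ 1ℚ :*ℚ G₁)))
    :+ℚ A :*ℚ ((conℚ 0ℚ :*ℚ G₁ :+ℚ C :*ℚ (conℚ 1ℚ :*ℚ G₁))
               :+ℚ B :*ℚ (conℚ 1ℚ :*ℚ G₁ :+ℚ C :*ℚ (conℚ (- ℕtoℚ 2) :*ℚ G₁)))
  :=ℚ G₀ :+ℚ (((A :*ℚ B :+ℚ A :*ℚ C) :+ℚ B :*ℚ C) :+ℚ conℚ (- ℕtoℚ 2) :*ℚ (A :*ℚ (B :*ℚ C))) :*ℚ G₁)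
  refl

maj₃-polynomial : ∀ a b c → boolToℚ (maj₃ (a ∷ b ∷ c ∷ [])) ≡ majPolynomial (boolToℚ a) (boolToℚ b) (boolToℚ c)
maj₃-polynomial true true true = refl
maj₃-polynomial true true false = refl
maj₃-polynomial true false true = refl
maj₃-polynomial true false false = refl
maj₃-polynomial false true true = refl
maj₃-polynomial false true false = refl
maj₃-polynomial false false true = refl
maj₃-polynomial false false false = refl

evalPoly-composeMajPoly : (p : MultPoly n) (x : Input (n * 3)) →
  evalPoly (composeMajPoly p) x ≡ evalPoly p (majorities x)
evalPoly-composeMajPoly {zero} p [] = refl
evalPoly-composeMajPoly {suc n} p (a ∷ b ∷ c ∷ x) = begin
  evalPoly P (a ∷ b ∷ c ∷ x)
    ≡⟨ evalPoly-cons P a (b ∷ c ∷ x) ⟩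
  interpolate (λ u → evalPoly (λ T → P (u ∷ T)) (b ∷ c ∷ x)) a′
    ≡⟨ interpolate-cong a′ (λ u → trans (evalPoly-cons (λ T → P (u ∷ T)) b (c ∷ x))
         (interpolate-cong b′ (λ v → trans (evalPoly-cons (λ T → P (u ∷ v ∷ T)) c x)
           (interpolate-cong c′ (λ w → block u v w))))) ⟩
  interpolate (λ u → interpolate (λ v → interpolate (λ w →
      majCoefficient u v w *ℚ (if u ∨ v ∨ w then G true else G false)) c′) b′) a′
    ≡⟨ majority-expansion a′ b′ c′ (G false) (G true) ⟩
  G false +ℚ majPolynomial a′ b′ c′ *ℚ G true
    ≡⟨ cong (λ q → G false +ℚ q *ℚ G true) (maj₃-polynomial a b c) ⟨
  interpolate G (boolToℚ (maj₃ (a ∷ b ∷ c ∷ [])))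
    ≡⟨ evalPoly-cons p (maj₃ (a ∷ b ∷ c ∷ [])) (majorities x) ⟨
  evalPoly p (majorities (a ∷ b ∷ c ∷ x)) ∎
  where
  open ≡-Reasoning
  P = composeMajPoly p
  a′ = boolToℚ a
  b′ = boolToℚ b
  c′ = boolToℚ c
  G : Bool → ℚ
  G u = evalPoly (λ S → p (u ∷ S)) (majorities x)
  block : ∀ u v w → evalPoly (λ T → P (u ∷ v ∷ w ∷ T)) x
                    ≡ majCoefficient u v w *ℚ (if u ∨ v ∨ w then G true else G false)
  block u v w = begin
    evalPoly (λ T → majCoefficient u v w *ℚ composeMajPoly (λ S → p ((u ∨ v ∨ w) ∷ S)) T) x
      ≡⟨ evalPoly-scale (majCoefficient u v w) _ x ⟩
    majCoefficient u v w *ℚ evalPoly (composeMajPoly (λ S → p ((u ∨ v ∨ w) ∷ S))) x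
      ≡⟨ cong (majCoefficient u v w *ℚ_) (evalPoly-composeMajPoly (λ S → p ((u ∨ v ∨ w) ∷ S)) x) ⟩
    majCoefficient u v w *ℚ G (u ∨ v ∨ w)
      ≡⟨ cong (majCoefficient u v w *ℚ_) (lift-if (u ∨ v ∨ w)) ⟩
    majCoefficient u v w *ℚ (if u ∨ v ∨ w then G true else G false) ∎
    where
    lift-if : ∀ t → G t ≡ (if t then G true else G false)
    lift-if true = refl
    lift-if false = refl

∈-allVecs : (S : Vec Bool m) → S ∈ allVecs m
∈-allVecs [] = here refl
∈-allVecs {suc m} (false ∷ S) = ∈P.∈-++⁺ˡ (∈P.∈-map⁺ (false ∷_) (∈-allVecs S))
∈-allVecs {suc m} (true ∷ S) = ∈P.∈-++⁺ʳ (mapˡ (false ∷_) (allVecs m)) (∈P.∈-map⁺ (true ∷_) (∈-allVecs S))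

-- Names the step function of the fold defining degPoly, which is local to its where block.
degStep : (p : MultPoly m) → Σ (Subset m → ℕ → ℕ) λ step → degPoly p ≡ foldrˡ step 0 (allVecs m)
degStep p = _ , refl

degStep-≥acc : (p : MultPoly m) (S : Subset m) (acc : ℕ) → acc ≤ proj₁ (degStep p) S acc
degStep-≥acc p S acc with p S ℚP.≟ 0ℚ
... | yes _ = ℕP.≤-refl
... | no _ = ℕP.m≤n⊔m _ _

degStep-≥support : (p : MultPoly m) (S : Subset m) (acc : ℕ) → p S ≢ 0ℚ → ∣ S ∣ ≤ proj₁ (degStep p) S acc
degStep-≥support p S acc pS≢0 with p S ℚP.≟ 0ℚ
... | yes pS≡0 = ⊥-elim (pS≢0 pS≡0)
... | no _ = ℕP.m≤m⊔n _ _

degStep-least : (p : MultPoly m) (S : Subset m) (acc d : ℕ) →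
  acc ≤ d → (p S ≢ 0ℚ → ∣ S ∣ ≤ d) → proj₁ (degStep p) S acc ≤ d
degStep-least p S acc d acc≤d S≤d with p S ℚP.≟ 0ℚ
... | yes _ = acc≤d
... | no pS≢0 = ℕP.⊔-lub (S≤d pS≢0) acc≤d

degPoly-≥ : (p : MultPoly m) (S : Subset m) → p S ≢ 0ℚ → ∣ S ∣ ≤ degPoly p
degPoly-≥ {m} p S pS≢0 = subst (∣ S ∣ ≤_) (sym (proj₂ (degStep p))) (go (allVecs m) (∈-allVecs S))
  where
  go : (Ss : List (Subset m)) → S ∈ Ss → ∣ S ∣ ≤ foldrˡ (proj₁ (degStep p)) 0 Ss
  go (T ∷ˡ Ss) (here refl) = degStep-≥support p S _ pS≢0
  go (T ∷ˡ Ss) (there S∈Ss) = ℕP.≤-trans (go Ss S∈Ss) (degStep-≥acc p T _)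

degPoly-least : (p : MultPoly m) (d : ℕ) → (∀ S → p S ≢ 0ℚ → ∣ S ∣ ≤ d) → degPoly p ≤ d
degPoly-least {m} p d bound = subst (_≤ d) (sym (proj₂ (degStep p))) (go (allVecs m))
  where
  go : (Ss : List (Subset m)) → foldrˡ (proj₁ (degStep p)) 0 Ss ≤ d
  go []ˡ = z≤n
  go (T ∷ˡ Ss) = degStep-least p T _ d (go Ss) (bound T)

*-≢0ˡ : (a b : ℚ) → a *ℚ b ≢ 0ℚ → a ≢ 0ℚ
*-≢0ˡ a b ab≢0 refl = ab≢0 (ℚP.*-zeroˡ b)

*-≢0ʳ : (a b : ℚ) → a *ℚ b ≢ 0ℚ → b ≢ 0ℚ
*-≢0ʳ a b ab≢0 refl = ab≢0 (ℚP.*-zeroʳ a)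

composeMajPoly-support : (p : MultPoly n) (T : Subset (n * 3)) → composeMajPoly p T ≢ 0ℚ →
  Σ (Subset n) λ S → p S ≢ 0ℚ × ∣ T ∣ ≤ ∣ S ∣ * 3
composeMajPoly-support {zero} p [] pT≢0 = [] , pT≢0 , z≤n
composeMajPoly-support {suc n} p (a ∷ b ∷ c ∷ T) pT≢0
  with composeMajPoly-support (λ S → p ((a ∨ b ∨ c) ∷ S)) T (*-≢0ʳ (majCoefficient a b c) _ pT≢0)
... | S , pS≢0 , T≤S = (a ∨ b ∨ c) ∷ S , pS≢0 , block a b c (*-≢0ˡ (majCoefficient a b c) _ pT≢0)
  where
  block : ∀ a b c → majCoefficient a b c ≢ 0ℚ → ∣ a ∷ b ∷ c ∷ T ∣ ≤ ∣ (a ∨ b ∨ c) ∷ S ∣ * 3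
  block false false false _ = T≤S
  block true false false μ≢0 = ⊥-elim (μ≢0 refl)
  block false true false μ≢0 = ⊥-elim (μ≢0 refl)
  block false false true μ≢0 = ⊥-elim (μ≢0 refl)
  block true true false _ = s≤s (s≤s (ℕP.m≤n⇒m≤1+n T≤S))
  block true false true _ = s≤s (s≤s (ℕP.m≤n⇒m≤1+n T≤S))
  block false true true _ = s≤s (s≤s (ℕP.m≤n⇒m≤1+n T≤S))
  block true true true _ = s≤s (s≤s (s≤s T≤S))

degPoly-composeMajPoly : (p : MultPoly n) → degPoly (composeMajPoly p) ≤ degPoly p * 3
degPoly-composeMajPoly p = degPoly-least (composeMajPoly p) _ λ T pT≢0 →
  let (S , pS≢0 , T≤S) = composeMajPoly-support p T pT≢0
  in ℕP.≤-trans T≤S (ℕP.*-monoˡ-≤ 3 (degPoly-≥ p S pS≢0))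

-- Existence of the block sensitivity

flip-empty : (x B : Input m) → Empty B → flip x B ≡ x
flip-empty [] [] _ = refl
flip-empty (a ∷ x) (true ∷ B) B-empty = ⊥-elim (B-empty (zero , hereᵛ))
flip-empty (a ∷ x) (false ∷ B) B-empty =
  cong₂ _∷_ (BoolP.xor-identityʳ a) (flip-empty x B (λ (i , i∈B) → B-empty (suc i , thereᵛ i∈B)))

sensitive-nonempty : (h : BoolFn m) (x B : Input m) → SensitiveBlock h x B → Nonempty B
sensitive-nonempty h x B sensitive with SubsetP.nonempty? B
... | yes B-nonempty = B-nonempty
... | no B-empty = ⊥-elim (sensitive (cong h (flip-empty x B B-empty)))

All-lookupᶠ : {P : A → Set} {xs : List A} → All P xs → (i : Fin (length xs)) → P (lookupˡ xs i)
All-lookupᶠ (px ∷ᵃ _) zero = px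
All-lookupᶠ (_ ∷ᵃ pxs) (suc i) = All-lookupᶠ pxs i

AllPairs-lookupᶠ : {R : A → A → Set} {xs : List A} → AllPairs R xs → {i j : Fin (length xs)} →
  i Fin.< j → R (lookupˡ xs i) (lookupˡ xs j)
AllPairs-lookupᶠ (Rx ∷ᵖ _) {zero} {suc j} _ = All-lookupᶠ Rx j
AllPairs-lookupᶠ (_ ∷ᵖ Rxs) {suc i} {suc j} (s≤s i<j) = AllPairs-lookupᶠ Rxs i<j

-- Sensitive blocks are nonempty, so picking a coordinate in each is injective on a disjoint family.
DisjSensFamily-length≤ : (h : BoolFn m) (x : Input m) (Bs : List (Subset m)) →
  DisjSensFamily h x Bs → length Bs ≤ m
DisjSensFamily-length≤ {m} h x Bs (sensitive , disjoint) with length Bs ≤? m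
... | yes length≤m = length≤m
... | no length≰m =
  let (i , j , i<j , wᵢ≡wⱼ) = FinP.pigeonhole (ℕP.≰⇒> length≰m) witness
  in ⊥-elim (AllPairs-lookupᶠ disjoint i<j
       (witness i , SubsetP.x∈p∩q⁺ (witness∈ i , subst (_∈ˢ lookupˡ Bs j) (sym wᵢ≡wⱼ) (witness∈ j))))
  where
  witness : Fin (length Bs) → Fin m
  witness i = proj₁ (sensitive-nonempty h x _ (All-lookupᶠ sensitive i))
  witness∈ : ∀ i → witness i ∈ˢ lookupˡ Bs i
  witness∈ i = proj₂ (sensitive-nonempty h x _ (All-lookupᶠ sensitive i))

listsOfLength : ℕ → List (List (Subset m))
listsOfLength zero = []ˡ ∷ˡ []ˡ
listsOfLength {m} (suc k) = cartesianProductWith _∷ˡ_ (allVecs m) (listsOfLength k)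

∈-listsOfLength : (Bs : List (Subset m)) → Bs ∈ listsOfLength (length Bs)
∈-listsOfLength []ˡ = here refl
∈-listsOfLength (B ∷ˡ Bs) = ∈P.∈-cartesianProductWith⁺ _∷ˡ_ (∈-allVecs B) (∈-listsOfLength Bs)

HasFamilyOfLength : BoolFn m → ℕ → Set
HasFamilyOfLength {m} h k =
  Σ (Input m) λ x → Σ (List (Subset m)) λ Bs → DisjSensFamily h x Bs × length Bs ≡ k

DisjSensFamily? : (h : BoolFn m) (x : Input m) (Bs : List (Subset m)) → Dec (DisjSensFamily h x Bs)
DisjSensFamily? h x Bs =
  All.all? (λ B → ¬? (h (flip x B) BoolP.≟ h x)) Bs
    ×-dec AllPairs.allPairs? (λ B C → ¬? (SubsetP.nonempty? (B ∩ C))) Bs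

HasFamilyOfLength? : (h : BoolFn m) (k : ℕ) → Dec (HasFamilyOfLength h k)
HasFamilyOfLength? {m} h k
  with Any.any? (λ x → Any.any? (λ Bs → DisjSensFamily? h x Bs ×-dec (length Bs ≟ k)) (listsOfLength k))
                (allVecs m)
... | yes found =
  let (x , found-x) = Any.satisfied found ; (Bs , family , length≡k) = Any.satisfied found-x
  in yes (x , Bs , family , length≡k)
... | no none = no λ (x , Bs , family , length≡k) →
  none (lose (∈-allVecs x) (lose (subst (λ k → Bs ∈ listsOfLength k) length≡k (∈-listsOfLength Bs))
                                 (family , length≡k)))

boundedMaximum : (P : ℕ → Set) → (∀ k → Dec (P k)) → P 0 → (t : ℕ) → (∀ k → P k → k ≤ t) →
  Σ ℕ λ b → P b × (∀ k → P k → k ≤ b)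
boundedMaximum P P? P0 t bounded with P? t
... | yes Pt = t , Pt , bounded
boundedMaximum P P? P0 zero bounded | no ¬P0 = ⊥-elim (¬P0 P0)
boundedMaximum P P? P0 (suc t) bounded | no ¬Pt+1 = boundedMaximum P P? P0 t bounded′
  where
  bounded′ : ∀ k → P k → k ≤ t
  bounded′ k Pk with ℕP.m≤n⇒m<n∨m≡n (bounded k Pk)
  ... | inj₁ k<t+1 = ℕP.≤-pred k<t+1
  ... | inj₂ refl = ⊥-elim (¬Pt+1 Pk)

bs-exists : (h : BoolFn m) → Σ ℕ (IsBS h)
bs-exists {m} h =
  let (b , (x , Bs , family , length≡b) , maximal) =
        boundedMaximum (HasFamilyOfLength h) (HasFamilyOfLength? h) (replicate m false , []ˡ , ([]ᵃ , []ᵖ) , refl) m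
          (λ k (x , Bs , family , length≡k) → subst (_≤ m) length≡k (DisjSensFamily-length≤ h x Bs family))
  in b , (x , Bs , family , length≡b) , λ x Bs family → maximal (length Bs) (x , Bs , family , refl)

-- Block sensitivity of f ∘ Maj₃ against fractional block sensitivity of f

count : (A → Bool) → List A → ℕ
count g []ˡ = 0
count g (a ∷ˡ as) = (if g a then 1 else 0) + count g as

count-zero : (g : A → Bool) (as : List A) → All (λ a → ¬ T (g a)) as → count g as ≡ 0
count-zero g []ˡ []ᵃ = refl
count-zero g (a ∷ˡ as) (¬ga ∷ᵃ rest) with g a
... | true = ⊥-elim (¬ga _)
... | false = count-zero g as rest

count-mono : (g h : A → Bool) (as : List A) → (∀ a → T (g a) → T (h a)) → count g as ≤ count h as
count-mono g h []ˡ g⇒h = z≤n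
count-mono g h (a ∷ˡ as) g⇒h with g a | h a | g⇒h a
... | true | true | _ = s≤s (count-mono g h as g⇒h)
... | true | false | impossible = ⊥-elim (impossible _)
... | false | true | _ = ℕP.m≤n⇒m≤1+n (count-mono g h as g⇒h)
... | false | false | _ = count-mono g h as g⇒h

count-≤-+ : (g h₁ h₂ : A → Bool) (as : List A) → (∀ a → T (g a) → T (h₁ a ∨ h₂ a)) →
  count g as ≤ count h₁ as + count h₂ as
count-≤-+ g h₁ h₂ []ˡ g⇒h = z≤n
count-≤-+ g h₁ h₂ (a ∷ˡ as) g⇒h with g a | h₁ a | h₂ a | g⇒h a
... | false | u | v | _ = ℕP.≤-trans (count-≤-+ g h₁ h₂ as g⇒h)
                          (ℕP.+-mono-≤ (ℕP.m≤n+m _ (if u then 1 else 0)) (ℕP.m≤n+m _ (if v then 1 else 0)))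
... | true | true | v | _ =
  s≤s (ℕP.≤-trans (count-≤-+ g h₁ h₂ as g⇒h) (ℕP.+-monoʳ-≤ (count h₁ as) (ℕP.m≤n+m _ (if v then 1 else 0))))
... | true | false | true | _ =
  subst (suc (count g as) ≤_) (sym (ℕP.+-suc (count h₁ as) (count h₂ as))) (s≤s (count-≤-+ g h₁ h₂ as g⇒h))
... | true | false | false | impossible = ⊥-elim (impossible _)

count-nonzero : (g : A → Bool) (as : List A) → count g as ≢ 0 → Any.Any (T ∘ g) as
count-nonzero g []ˡ count≢0 = ⊥-elim (count≢0 refl)
count-nonzero g (a ∷ˡ as) count≢0 with g a in ga
... | true = here (subst T (sym ga) _)
... | false = there (count-nonzero g as count≢0)

count-true : (as : List A) → count (λ _ → true) as ≡ length as
count-true []ˡ = refl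
count-true (a ∷ˡ as) = cong suc (count-true as)

count-disjoint≤1 : (i : Fin m) (Bs : List (Subset m)) → AllPairs Disjoint Bs → count (λ B → lookup B i) Bs ≤ 1
count-disjoint≤1 i []ˡ []ᵖ = z≤n
count-disjoint≤1 i (B ∷ˡ Bs) (B-disjoint ∷ᵖ disjoint) with lookup B i in Bᵢ
... | false = count-disjoint≤1 i Bs disjoint
... | true = s≤s (ℕP.≤-reflexive (count-zero _ Bs (All.map (λ {C} B∩C≡∅ Cᵢ → B∩C≡∅ (i , i∈B∩C Cᵢ)) B-disjoint)))
  where
  i∈B∩C : ∀ {C} → T (lookup C i) → i ∈ˢ B ∩ C
  i∈B∩C {C} Cᵢ = SubsetP.x∈p∩q⁺ (VecP.lookup⇒[]= i B Bᵢ , VecP.lookup⇒[]= i C (Equivalence.to BoolP.T-≡ Cᵢ))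

agreeingPair : Vec Bool 3 → Fin 3 × Fin 3
agreeingPair (a ∷ b ∷ c ∷ []) =
  if not (a xor b) then (zero , suc zero)
  else if not (a xor c) then (zero , suc (suc zero))
  else (suc zero , suc (suc zero))

-- Changing the majority requires a flip at one of the two agreeing positions;
-- maj₃-flipᵇ-holds checks this on all 64 cases by evaluation.
maj₃-flipᵇ : Vec Bool 3 → Vec Bool 3 → Bool
maj₃-flipᵇ u p = not (maj₃ (zipWith _xor_ u p) xor maj₃ u)
                   ∨ (lookup p (proj₁ (agreeingPair u)) ∨ lookup p (proj₂ (agreeingPair u)))

maj₃-flipᵇ-holds : ∀ u p → T (maj₃-flipᵇ u p)
maj₃-flipᵇ-holds u p = All.lookup (All.lookup exhaustive (∈-allVecs u)) (∈-allVecs p)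
  where
  exhaustive : All (λ u → All (λ p → T (maj₃-flipᵇ u p)) (allVecs 3)) (allVecs 3)
  exhaustive = toWitness {a? = All.all? (λ u → All.all? (λ p → BoolP.T? (maj₃-flipᵇ u p)) (allVecs 3)) (allVecs 3)} _

maj₃-flip : (u p : Vec Bool 3) → T (maj₃ (zipWith _xor_ u p) xor maj₃ u) →
  T (lookup p (proj₁ (agreeingPair u)) ∨ lookup p (proj₂ (agreeingPair u)))
maj₃-flip u p flips with maj₃ (zipWith _xor_ u p) xor maj₃ u | maj₃-flipᵇ-holds u p
... | true | hit = hit

majorityFlips : Input (n * 3) → Subset (n * 3) → Subset n
majorityFlips {n} x B = zipWith _xor_ (majorities {n} (flip x B)) (majorities x)

flip-majorityFlips : (x B : Input (n * 3)) → flip (majorities {n} x) (majorityFlips x B) ≡ majorities (flip x B)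
flip-majorityFlips {n} x B = cancel (majorities {n} x) (majorities (flip x B))
  where
  cancel : ∀ {k} (y z : Vec Bool k) → zipWith _xor_ y (zipWith _xor_ z y) ≡ z
  cancel [] [] = refl
  cancel (a ∷ y) (b ∷ z) = cong₂ _∷_ (solve 2 (λ a b → a :+ (b :+ a) := b) refl a b) (cancel y z)

lookup-majorityFlips : (x B : Input (n * 3)) (j : Fin n) →
  lookup (majorityFlips x B) j ≡ maj₃ (zipWith _xor_ (blockAt x j) (blockAt B j)) xor maj₃ (blockAt x j)
lookup-majorityFlips {n} x B j = begin
  lookup (majorityFlips x B) j
    ≡⟨ VecP.lookup-zipWith _xor_ j (majorities {n} (flip x B)) (majorities x) ⟩
  lookup (majorities (flip x B)) j xor lookup (majorities x) j
    ≡⟨ cong₂ _xor_ (lookup-majorities (flip x B) j) (lookup-majorities x j) ⟩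
  maj₃ (blockAt (flip x B) j) xor maj₃ (blockAt x j)
    ≡⟨ cong (λ u → maj₃ u xor maj₃ (blockAt x j)) (blockAt-zipWith _xor_ x B j) ⟩
  maj₃ (zipWith _xor_ (blockAt x j) (blockAt B j)) xor maj₃ (blockAt x j) ∎
  where open ≡-Reasoning

count-majorityFlips≤2 : (x : Input (n * 3)) (Bs : List (Subset (n * 3))) → AllPairs Disjoint Bs →
  (j : Fin n) → count (λ B → lookup (majorityFlips x B) j) Bs ≤ 2
count-majorityFlips≤2 x Bs disjoint j =
  ℕP.≤-trans (count-≤-+ _ (λ B → lookup B i₁) (λ B → lookup B i₂) Bs hits)
             (ℕP.+-mono-≤ (count-disjoint≤1 i₁ Bs disjoint) (count-disjoint≤1 i₂ Bs disjoint))
  where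
  u = blockAt x j
  i₁ = blockIndex j (proj₁ (agreeingPair u))
  i₂ = blockIndex j (proj₂ (agreeingPair u))
  hits : ∀ B → T (lookup (majorityFlips x B) j) → T (lookup B i₁ ∨ lookup B i₂)
  hits B flips =
    subst T (cong₂ _∨_ (lookup-blockAt B j (proj₁ (agreeingPair u))) (lookup-blockAt B j (proj₂ (agreeingPair u))))
      (maj₃-flip u (blockAt B j) (subst T (lookup-majorityFlips x B j) flips))

ℕtoℚ-mkℚ : ∀ a → ℕtoℚ a ≡ mkℚ (ℤ.+ a) 0 (Coprimality.sym (Coprimality.1-coprimeTo a))
ℕtoℚ-mkℚ a = ℚP.normalize-coprime (Coprimality.sym (Coprimality.1-coprimeTo a))

ℕtoℚ-+ : ∀ a b → ℕtoℚ (a + b) ≡ ℕtoℚ a +ℚ ℕtoℚ b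
ℕtoℚ-+ a b rewrite ℕtoℚ-mkℚ a | ℕtoℚ-mkℚ b =
  sym (ℚP./-cong {p₁ = ℤ.+ a ℤ.* ℤ.+ 1 ℤ.+ ℤ.+ b ℤ.* ℤ.+ 1} {q₁ = 1} {p₂ = ℤ.+ (a + b)} {q₂ = 1}
        (trans (cong₂ ℤ._+_ (ℤP.*-identityʳ (ℤ.+ a)) (ℤP.*-identityʳ (ℤ.+ b))) (sym (ℤP.pos-+ a b))) refl)

ℕtoℚ-* : ∀ a b → ℕtoℚ (a * b) ≡ ℕtoℚ a *ℚ ℕtoℚ b
ℕtoℚ-* a b rewrite ℕtoℚ-mkℚ a | ℕtoℚ-mkℚ b =
  sym (ℚP./-cong {p₁ = ℤ.+ a ℤ.* ℤ.+ b} {q₁ = 1} {p₂ = ℤ.+ (a * b)} {q₂ = 1} (sym (ℤP.pos-* a b)) refl)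

ℕtoℚ-mono : ∀ {a b} → a ≤ b → ℕtoℚ a ≤ℚ ℕtoℚ b
ℕtoℚ-mono {a} {b} a≤b rewrite ℕtoℚ-mkℚ a | ℕtoℚ-mkℚ b =
  *≤* (subst₂ ℤ._≤_ (sym (ℤP.*-identityʳ (ℤ.+ a))) (sym (ℤP.*-identityʳ (ℤ.+ b))) (ℤ.+≤+ a≤b))

ℕtoℚ-nonNeg : ∀ a → 0ℚ ≤ℚ ℕtoℚ a
ℕtoℚ-nonNeg a = ℕtoℚ-mono {0} {a} z≤n

sumℚ-allVecs-point : (F : Vec Bool m → ℚ) (C : Vec Bool m) → (∀ S → S ≢ C → F S ≡ 0ℚ) →
  sumℚ (mapˡ F (allVecs m)) ≡ F C
sumℚ-allVecs-point F [] F≡0 = ℚP.+-identityʳ (F [])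
sumℚ-allVecs-point {suc m} F (false ∷ C) F≡0 =
  trans (sumℚ-allVecs-suc F)
    (trans (cong₂ _+ℚ_ (sumℚ-allVecs-point (λ S → F (false ∷ S)) C
                          (λ S S≢C → F≡0 (false ∷ S) (S≢C ∘ VecP.∷-injectiveʳ)))
                       (sumℚ-zero (λ S → F (true ∷ S)) (allVecs m) (λ S → F≡0 (true ∷ S) (λ ()))))
           (ℚP.+-identityʳ (F (false ∷ C))))
sumℚ-allVecs-point {suc m} F (true ∷ C) F≡0 =
  trans (sumℚ-allVecs-suc F)
    (trans (cong₂ _+ℚ_ (sumℚ-zero (λ S → F (false ∷ S)) (allVecs m) (λ S → F≡0 (false ∷ S) (λ ())))
                       (sumℚ-allVecs-point (λ S → F (true ∷ S)) C
                          (λ S S≢C → F≡0 (true ∷ S) (S≢C ∘ VecP.∷-injectiveʳ))))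
           (ℚP.+-identityˡ (F (true ∷ C))))

_≟ˢ_ : (S T : Subset m) → Dec (S ≡ T)
_≟ˢ_ = VecP.≡-dec BoolP._≟_

≟ˢ-sound : (S C : Subset m) → T (does (S ≟ˢ C)) → S ≡ C
≟ˢ-sound S C S≟C with S ≟ˢ C
... | yes S≡C = S≡C

-- weightAt w i and totalWeight w are, definitionally, restrictedSum (λ S → lookup S i) w
-- and restrictedSum (λ _ → true) w.
restrictedSum : (Subset m → Bool) → Weights m → ℚ
restrictedSum {m} g w = sumℚ (mapˡ (λ S → if g S then w S else 0ℚ) (allVecs m))

restrictedSum-+ : (g : Subset m → Bool) (v w : Weights m) →
  restrictedSum g (λ S → v S +ℚ w S) ≡ restrictedSum g v +ℚ restrictedSum g w
restrictedSum-+ {m} g v w =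
  trans (sumℚ-cong (allVecs m) split)
        (sumℚ-+ (λ S → if g S then v S else 0ℚ) (λ S → if g S then w S else 0ℚ) (allVecs m))
  where
  split : ∀ S → (if g S then v S +ℚ w S else 0ℚ) ≡ (if g S then v S else 0ℚ) +ℚ (if g S then w S else 0ℚ)
  split S with g S
  ... | true = refl
  ... | false = refl

restrictedSum-point : (g : Subset m → Bool) (C : Subset m) (q : ℚ) →
  restrictedSum g (λ S → if does (S ≟ˢ C) then q else 0ℚ) ≡ (if g C then q else 0ℚ)
restrictedSum-point g C q =
  trans (sumℚ-allVecs-point _ C off-C)
        (cong (λ b → if g C then (if b then q else 0ℚ) else 0ℚ) (dec-true (C ≟ˢ C) refl))
  where
  off-C : ∀ S → S ≢ C → (if g S then (if does (S ≟ˢ C) then q else 0ℚ) else 0ℚ) ≡ 0ℚ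
  off-C S S≢C rewrite dec-false (S ≟ˢ C) S≢C with g S
  ... | true = refl
  ... | false = refl

halfCount : (A → Subset m) → List A → Weights m
halfCount C Bs S = ℕtoℚ (count (λ B → does (S ≟ˢ C B)) Bs) *ℚ ½

half-mono : ∀ {a b} → a ≤ b → ℕtoℚ a *ℚ ½ ≤ℚ ℕtoℚ b *ℚ ½
half-mono a≤b = ℚP.*-monoʳ-≤-nonNeg ½ (ℕtoℚ-mono a≤b)

halfCount-≥0 : (C : A → Subset m) (Bs : List A) (S : Subset m) → 0ℚ ≤ℚ halfCount C Bs S
halfCount-≥0 C Bs S = half-mono {0} {count (λ B → does (S ≟ˢ C B)) Bs} z≤n

halfCount-≤1 : (C : A → Subset m) (Bs : List A) (S : Subset m) →
  count (λ B → does (S ≟ˢ C B)) Bs ≤ 2 → halfCount C Bs S ≤ℚ 1ℚ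
halfCount-≤1 C Bs S = half-mono {b = 2}

half-indicator-+ : (b : Bool) (c : ℕ) →
  ℕtoℚ ((if b then 1 else 0) + c) *ℚ ½ ≡ (if b then ½ else 0ℚ) +ℚ ℕtoℚ c *ℚ ½
half-indicator-+ b c = begin
  ℕtoℚ (δ + c) *ℚ ½              ≡⟨ cong (_*ℚ ½) (ℕtoℚ-+ δ c) ⟩
  (ℕtoℚ δ +ℚ ℕtoℚ c) *ℚ ½        ≡⟨ ℚP.*-distribʳ-+ ½ (ℕtoℚ δ) (ℕtoℚ c) ⟩
  ℕtoℚ δ *ℚ ½ +ℚ ℕtoℚ c *ℚ ½     ≡⟨ cong (_+ℚ ℕtoℚ c *ℚ ½) (indicator b) ⟩
  (if b then ½ else 0ℚ) +ℚ ℕtoℚ c *ℚ ½ ∎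
  where
  open ≡-Reasoning
  δ = if b then 1 else 0
  indicator : ∀ b → ℕtoℚ (if b then 1 else 0) *ℚ ½ ≡ (if b then ½ else 0ℚ)
  indicator true = refl
  indicator false = refl

restrictedSum-halfCount : (g : Subset m → Bool) (C : A → Subset m) (Bs : List A) →
  restrictedSum g (halfCount C Bs) ≡ ℕtoℚ (count (g ∘ C) Bs) *ℚ ½
restrictedSum-halfCount {m} g C []ˡ = sumℚ-zero _ (allVecs m) zero-weight
  where
  zero-weight : ∀ S → (if g S then 0ℚ else 0ℚ) ≡ 0ℚ
  zero-weight S with g S
  ... | true = refl
  ... | false = refl
restrictedSum-halfCount {m} g C (B ∷ˡ Bs) = begin
  restrictedSum g (halfCount C (B ∷ˡ Bs))
    ≡⟨ sumℚ-cong (allVecs m) (λ S → cong (λ q → if g S then q else 0ℚ) (half-indicator-+ (does (S ≟ˢ C B)) _)) ⟩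
  restrictedSum g (λ S → (if does (S ≟ˢ C B) then ½ else 0ℚ) +ℚ halfCount C Bs S)
    ≡⟨ restrictedSum-+ g _ (halfCount C Bs) ⟩
  restrictedSum g (λ S → if does (S ≟ˢ C B) then ½ else 0ℚ) +ℚ restrictedSum g (halfCount C Bs)
    ≡⟨ cong₂ _+ℚ_ (restrictedSum-point g (C B) ½) (restrictedSum-halfCount g C Bs) ⟩
  (if g (C B) then ½ else 0ℚ) +ℚ ℕtoℚ (count (g ∘ C) Bs) *ℚ ½
    ≡⟨ half-indicator-+ (g (C B)) (count (g ∘ C) Bs) ⟨
  ℕtoℚ (count (g ∘ C) (B ∷ˡ Bs)) *ℚ ½ ∎
  where open ≡-Reasoning

majorityFlips-sensitive : (f : BoolFn n) (x B : Input (n * 3)) →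
  SensitiveBlock (composeMaj f) x B → SensitiveBlock f (majorities x) (majorityFlips x B)
majorityFlips-sensitive f x B sensitive = sensitive ∘ trans (cong f (sym (flip-majorityFlips x B)))

count-majorityFlips-image≤2 : (f : BoolFn n) (x : Input (n * 3)) (Bs : List (Subset (n * 3))) →
  DisjSensFamily (composeMaj f) x Bs → (S : Subset n) → count (λ B → does (S ≟ˢ majorityFlips x B)) Bs ≤ 2
count-majorityFlips-image≤2 f x Bs (sensitive , disjoint) S with SubsetP.nonempty? S
... | yes (i , i∈S) = ℕP.≤-trans (count-mono _ _ Bs hits-i) (count-majorityFlips≤2 x Bs disjoint i)
  where
  hits-i : ∀ B → T (does (S ≟ˢ majorityFlips x B)) → T (lookup (majorityFlips x B) i)
  hits-i B S≟flips =
    subst (λ C → T (lookup C i)) (≟ˢ-sound S (majorityFlips x B) S≟flips) (subst T (sym (VecP.[]=⇒lookup i∈S)) _)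
... | no S-empty = subst (_≤ 2) (sym (count-zero _ Bs (All.map not-image sensitive))) z≤n
  where
  not-image : ∀ {B} → SensitiveBlock (composeMaj f) x B → ¬ T (does (S ≟ˢ majorityFlips x B))
  not-image {B} B-sensitive S≟flips = S-empty (subst Nonempty (sym (≟ˢ-sound S (majorityFlips x B) S≟flips))
    (sensitive-nonempty f (majorities x) _ (majorityFlips-sensitive f x B B-sensitive)))

halfBS≤FBS-composeMaj : (f : BoolFn n) (b : ℕ) (q : ℚ) → IsBS (composeMaj f) b → IsFBS f q → ℕtoℚ b *ℚ ½ ≤ℚ q
halfBS≤FBS-composeMaj {n} f b q ((x , Bs , family@(sensitive , disjoint) , length≡b) , _) (_ , fbs-max) =
  subst (_≤ℚ q) total (fbs-max y w (halfCount-≥0 (majorityFlips x) Bs , ≤1 , supported , load≤1))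
  where
  y = majorities x
  w = halfCount (majorityFlips x) Bs
  ≤1 : ∀ S → w S ≤ℚ 1ℚ
  ≤1 S = halfCount-≤1 (majorityFlips x) Bs S (count-majorityFlips-image≤2 f x Bs family S)
  supported : ∀ S → w S ≢ 0ℚ → SensitiveBlock f y S
  supported S wS≢0 =
    let image = count-nonzero _ Bs (λ c≡0 → wS≢0 (cong (λ c → ℕtoℚ c *ℚ ½) c≡0))
        (B-sensitive , S≟flips) = All.lookupAny sensitive image
    in subst (SensitiveBlock f y) (sym (≟ˢ-sound S (majorityFlips x (Any.lookup image)) S≟flips))
             (majorityFlips-sensitive f x _ B-sensitive)
  load≤1 : ∀ i → weightAt w i ≤ℚ 1ℚ
  load≤1 i = subst (_≤ℚ 1ℚ) (sym (restrictedSum-halfCount (λ S → lookup S i) (majorityFlips x) Bs))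
                   (half-mono {b = 2} (count-majorityFlips≤2 x Bs disjoint i))
  total : totalWeight w ≡ ℕtoℚ b *ℚ ½
  total = trans (restrictedSum-halfCount {n} (λ _ → true) (majorityFlips x) Bs)
                (cong (λ c → ℕtoℚ c *ℚ ½) (trans (count-true Bs) length≡b))

-- Rescaling the bounds from 3n to n variables

^-distribʳ-* : ∀ a b k → (a * b) ^ k ≡ a ^ k * b ^ k
^-distribʳ-* a b zero = refl
^-distribʳ-* a b (suc k) rewrite ^-distribʳ-* a b k =
  solveℕ 4 (λ a b x y → (a :*ℕ b) :*ℕ (x :*ℕ y) :=ℕ (a :*ℕ x) :*ℕ (b :*ℕ y)) refl a b (a ^ k) (b ^ k)

⌈log₂3n⌉≤3⌈log₂n⌉ : ∀ n → 2 ≤ n → ⌈log₂ (n * 3) ⌉ ≤ 3 * ⌈log₂ n ⌉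
⌈log₂3n⌉≤3⌈log₂n⌉ n@(suc _) 2≤n = begin
  ⌈log₂ (n * 3) ⌉
    ≤⟨ ⌈log₂⌉-mono-≤ (ℕP.≤-trans (ℕP.*-monoʳ-≤ n (ℕP.n≤1+n 3)) (ℕP.≤-reflexive n*4≡2*[2*n])) ⟩
  ⌈log₂ (2 * (2 * n)) ⌉
    ≡⟨ ⌈log₂2*n⌉≡1+⌈log₂n⌉ (2 * n) {{_}} ⟩
  1 + ⌈log₂ (2 * n) ⌉
    ≡⟨ cong suc (⌈log₂2*n⌉≡1+⌈log₂n⌉ n) ⟩
  2 + ⌈log₂ n ⌉
    ≤⟨ ℕP.+-monoˡ-≤ ⌈log₂ n ⌉ (ℕP.*-monoʳ-≤ 2 (⌈log₂⌉-mono-≤ 2≤n)) ⟩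
  2 * ⌈log₂ n ⌉ + ⌈log₂ n ⌉
    ≡⟨ solveℕ 1 (λ l → conℕ 2 :*ℕ l :+ℕ l :=ℕ conℕ 3 :*ℕ l) refl ⌈log₂ n ⌉ ⟩
  3 * ⌈log₂ n ⌉ ∎
  where
  open ℕP.≤-Reasoning
  n*4≡2*[2*n] : n * 4 ≡ 2 * (2 * n)
  n*4≡2*[2*n] = solveℕ 1 (λ n → n :*ℕ conℕ 4 :=ℕ conℕ 2 :*ℕ (conℕ 2 :*ℕ n)) refl n

log-rescale : ∀ c X k n → 2 ≤ n → c * X * ⌈log₂ (n * 3) ⌉ ^ k ≤ c * 3 ^ k * X * ⌈log₂ n ⌉ ^ k
log-rescale c X k n 2≤n = begin
  c * X * ⌈log₂ (n * 3) ⌉ ^ k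
    ≤⟨ ℕP.*-monoʳ-≤ (c * X) (ℕP.^-monoˡ-≤ k (⌈log₂3n⌉≤3⌈log₂n⌉ n 2≤n)) ⟩
  c * X * (3 * ⌈log₂ n ⌉) ^ k
    ≡⟨ cong (c * X *_) (^-distribʳ-* 3 ⌈log₂ n ⌉ k) ⟩
  c * X * (3 ^ k * ⌈log₂ n ⌉ ^ k)
    ≡⟨ solveℕ 4 (λ c X P L → c :*ℕ X :*ℕ (P :*ℕ L) :=ℕ c :*ℕ P :*ℕ X :*ℕ L) refl c X (3 ^ k) (⌈log₂ n ⌉ ^ k) ⟩
  c * 3 ^ k * X * ⌈log₂ n ⌉ ^ k ∎
  where open ℕP.≤-Reasoning

2≤n*3 : ∀ n → 2 ≤ n → 2 ≤ n * 3
2≤n*3 n 2≤n = ℕP.≤-trans 2≤n (ℕP.m≤m*n n 3)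

D≤-weaken : {f : BoolFn n} {d e : ℕ} → d ≤ e → D≤ f d → D≤ f e
D≤-weaken d≤e (t , t≈f , depth≤d) = t , t≈f , ℕP.≤-trans depth≤d d≤e

square-mono : {a c : ℚ} → 0ℚ ≤ℚ a → a ≤ℚ c → a *ℚ a ≤ℚ c *ℚ c
square-mono {a} {c} 0≤a a≤c =
  ℚP.≤-trans (ℚP.*-monoʳ-≤-nonNeg a {{nonNegative 0≤a}} a≤c)
             (ℚP.*-monoˡ-≤-nonNeg c {{nonNegative (ℚP.≤-trans 0≤a a≤c)}} a≤c)

square≤4square : ∀ b q → ℕtoℚ b *ℚ ½ ≤ℚ q → ℕtoℚ (b ^ 2) ≤ℚ ℕtoℚ 4 *ℚ (q *ℚ q)
square≤4square b q b/2≤q = begin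
  ℕtoℚ (b ^ 2)
    ≡⟨ cong ℕtoℚ (cong (b *_) (ℕP.*-identityʳ b)) ⟩
  ℕtoℚ (b * b)
    ≡⟨ ℕtoℚ-* b b ⟩
  ℕtoℚ b *ℚ ℕtoℚ b
    ≡⟨ solveℚ 1 (λ B → B :*ℚ B :=ℚ conℚ (ℕtoℚ 4) :*ℚ ((B :*ℚ conℚ ½) :*ℚ (B :*ℚ conℚ ½)))
                refl (ℕtoℚ b) ⟩
  ℕtoℚ 4 *ℚ ((ℕtoℚ b *ℚ ½) *ℚ (ℕtoℚ b *ℚ ½))
    ≤⟨ ℚP.*-monoˡ-≤-nonNeg (ℕtoℚ 4) (square-mono (half-mono {0} {b} z≤n) b/2≤q) ⟩
  ℕtoℚ 4 *ℚ (q *ℚ q) ∎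
  where open ℚP.≤-Reasoning

ℕtoℚ-scaled-bound : ∀ K B L q → ℕtoℚ B ≤ℚ ℕtoℚ 4 *ℚ (q *ℚ q) →
  ℕtoℚ (K * B * L) ≤ℚ (ℕtoℚ (4 * K) *ℚ (q *ℚ q)) *ℚ ℕtoℚ L
ℕtoℚ-scaled-bound K B L q B≤4q² = begin
  ℕtoℚ (K * B * L)
    ≡⟨ trans (ℕtoℚ-* (K * B) L) (cong (_*ℚ ℕtoℚ L) (ℕtoℚ-* K B)) ⟩
  (ℕtoℚ K *ℚ ℕtoℚ B) *ℚ ℕtoℚ L
    ≤⟨ ℚP.*-monoʳ-≤-nonNeg (ℕtoℚ L) {{nonNegative (ℕtoℚ-nonNeg L)}}
         (ℚP.*-monoˡ-≤-nonNeg (ℕtoℚ K) {{nonNegative (ℕtoℚ-nonNeg K)}} B≤4q²) ⟩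
  (ℕtoℚ K *ℚ (ℕtoℚ 4 *ℚ (q *ℚ q))) *ℚ ℕtoℚ L
    ≡⟨ cong (_*ℚ ℕtoℚ L) (trans (sym (ℚP.*-assoc (ℕtoℚ K) (ℕtoℚ 4) (q *ℚ q)))
         (cong (_*ℚ (q *ℚ q)) (trans (ℚP.*-comm (ℕtoℚ K) (ℕtoℚ 4)) (sym (ℕtoℚ-* 4 K))))) ⟩
  (ℕtoℚ (4 * K) *ℚ (q *ℚ q)) *ℚ ℕtoℚ L ∎
  where open ℚP.≤-Reasoning

degree-rescale : ∀ c k D d L → D ≤ d * 3 → c * 3 ^ k * D ^ 2 * L ≤ c * 9 * 3 ^ k * d ^ 2 * L
degree-rescale c k D d L D≤3d = begin
  c * 3 ^ k * D ^ 2 * L        ≤⟨ ℕP.*-monoˡ-≤ L (ℕP.*-monoʳ-≤ (c * 3 ^ k) (ℕP.^-monoˡ-≤ 2 D≤3d)) ⟩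
  c * 3 ^ k * (d * 3) ^ 2 * L  ≡⟨ solveℕ 4 (λ c P d L → c :*ℕ P :*ℕ ((d :*ℕ conℕ 3) :^ℕ 2) :*ℕ L
                                                    :=ℕ c :*ℕ conℕ 9 :*ℕ P :*ℕ (d :^ℕ 2) :*ℕ L) refl c (3 ^ k) d L ⟩
  c * 9 * 3 ^ k * d ^ 2 * L    ∎
  where open ℕP.≤-Reasoning

part1 : ∀ M → Part1 M
part1 M (c₁ , k₁ , 1≤c₁ , 1≤k₁ , M≤deg) = c₁ * 9 * 3 ^ k₁ , k₁ , 1≤c₂ , 1≤k₁ , D≤deg
  where
  1≤c₂ : 1 ≤ c₁ * 9 * 3 ^ k₁
  1≤c₂ = ℕP.*-mono-≤ (ℕP.*-mono-≤ 1≤c₁ (s≤s z≤n)) (ℕP.m^n>0 3 k₁)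
  D≤deg : ∀ n → 2 ≤ n → (f : BoolFn n) (p : MultPoly n) → Represents p f →
    D≤ f (c₁ * 9 * 3 ^ k₁ * (degPoly p ^ 2) * (⌈log₂ n ⌉ ^ k₁))
  D≤deg n 2≤n f p p≈f =
    D≤-weaken (ℕP.≤-trans (log-rescale c₁ (degPoly P ^ 2) k₁ n 2≤n)
                          (degree-rescale c₁ k₁ (degPoly P) (degPoly p) _ (degPoly-composeMajPoly p)))
      (D≤-from-composeMaj M f _ (M≤deg (n * 3) (2≤n*3 n 2≤n) (composeMaj f) P P≈F))
    where
    P = composeMajPoly p
    P≈F : Represents P (composeMaj f)
    P≈F x = trans (evalPoly-composeMajPoly p x) (p≈f (majorities x))

part2 : ∀ M → Part2 M
part2 M (c₁ , k₁ , 1≤c₁ , 1≤k₁ , M≤bs) = 4 * (c₁ * 3 ^ k₁) , k₁ , 1≤c₂ , 1≤k₁ , D≤fbs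
  where
  1≤c₂ : 1 ≤ 4 * (c₁ * 3 ^ k₁)
  1≤c₂ = ℕP.*-mono-≤ {1} {4} (s≤s z≤n) (ℕP.*-mono-≤ 1≤c₁ (ℕP.m^n>0 3 k₁))
  D≤fbs : ∀ n → 2 ≤ n → (f : BoolFn n) (q : ℚ) → IsFBS f q →
    Σ ℕ λ d → D≤ f d × ℕtoℚ d ≤ℚ (ℕtoℚ (4 * (c₁ * 3 ^ k₁)) *ℚ (q *ℚ q)) *ℚ ℕtoℚ (⌈log₂ n ⌉ ^ k₁)
  D≤fbs n 2≤n f q fbs =
    d , D≤-from-composeMaj M f d (M≤bs (n * 3) (2≤n*3 n 2≤n) (composeMaj f) b bs) ,
    ℚP.≤-trans (ℕtoℚ-mono (log-rescale c₁ (b ^ 2) k₁ n 2≤n))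
               (ℕtoℚ-scaled-bound (c₁ * 3 ^ k₁) (b ^ 2) (⌈log₂ n ⌉ ^ k₁) q
                 (square≤4square b q (halfBS≤FBS-composeMaj f b q bs fbs)))
    where
    b = proj₁ (bs-exists (composeMaj f))
    bs = proj₂ (bs-exists (composeMaj f))
    d = c₁ * (b ^ 2) * (⌈log₂ (n * 3) ⌉ ^ k₁)

theorem5 : (M : Measure) → Part1 M × Part2 M
theorem5 M = part1 M , part2 M
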